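{- Let $\Phi=B_1|\cdots|B_k$ be a set composition of $n$ and $\Psi$ a set composition. Then \[ P_\Phi P_\Psi = \sum_{\Gamma \in \Phi\sqcup\!\sqcup(\Psi \uparrow n)}P_\Gamma, \qquad \Delta(P_\Phi)=\sum_{i=0}^{k}P_{st(B_1|\cdots|B_i)}\otimes P_{st(B_{i+1}|\cdots|B_k)}. \]
   Context: A set composition $\Phi=B_1|\cdots|B_k$ of $n$ is a sequence of pairwise disjoint nonempty subsets of $[n]$ with $|B_1|+\dots+|B_k|=n$. For a word $a_1\cdots a_n$, $\varrho$ gives the set composition with $i$ in block number $|\{a_l:a_l<a_i\}|+1$; $\mathrm{NCQSym}$ has basis $M_\Phi=\sum_{\varrho(a)=\Phi}x_{a_1}\cdots x_{a_n}$ in noncommuting variables. Order sets by $A>_{\widetilde{\mathcal D}}B$ if $|A|>|B|$, or $|A|=|B|$ and $\min A<\min B$. A labelled diagonal descending (LDD) filling of $\Phi$ places $B_i$ in row $i$ of a matrix, $B_1$ in the first column, and $B_{i+1}$ may be in the same column as $B_i$ if $B_i>_{\widetilde{\mathcal D}}B_{i+1}$, otherwise it is in the next column to the right; $\mathsf{col}$ of a filling is the set composition of unions of the sets in each column. Define $P_\Phi=\sum_{\tilde{\mathsf F}\in\mathsf{LDD}(\Phi)}M_{\mathsf{col}(\tilde{\mathsf F})}$. For set compositions $\Phi=B_1|\cdots|B_k$ and $\Psi=A_1|\cdots|A_j$ with all blocks disjoint, the shuffle is defined recursively by $\emptyset\sqcup\!\sqcup\Phi=\Phi\sqcup\!\sqcup\emptyset=\Phi$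 and $\Phi\sqcup\!\sqcup\Psi=B_1|\big((B_2|\cdots|B_k)\sqcup\!\sqcup\Psi\big)+A_1|\big(\Phi\sqcup\!\sqcup(A_2|\cdots|A_j)\big)$. $\Psi\uparrow n$ adds $n$ to every element of every block of $\Psi$. The standardization $st(\Phi)$ of a sequence of disjoint sets with $m$ total elements is the set composition of $[m]$ obtained by replacing elements by $1,\dots,m$ preserving relative order. -}

module Defs where

open import Data.Bool using (Bool; true; false; if_then_else_; _∧_; _∨_; not)
open import Data.Nat using (ℕ; zero; suc; _+_; _*_; _⊔_; _<_; _≤ᵇ_; _<ᵇ_; _≡ᵇ_; _≟_)
open import Data.Nat.ListAction using (sum)
open import Data.List using (List; []; _∷_; _++_; map; concat; length; filterᵇ; upTo; take; drop; zip; foldr; null)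
open import Data.List.Properties using (≡-dec)
open import Data.List.Relation.Unary.All using (All)
open import Data.List.Relation.Unary.Linked using (Linked)
open import Data.List.Relation.Binary.Permutation.Propositional using (_↭_)
open import Data.Product using (_×_; _,_; proj₁; proj₂)
open import Relation.Nullary using (does; ¬_)
open import Relation.Binary.PropositionalEquality using (_≡_)

-- A finite set of positive integers is encoded canonically as a strictly
-- increasing list; a set composition as the list of its blocks.
Block : Set
Block = List ℕ

SetComp : Set
SetComp = List Block

range : ℕ → List ℕ
range n = map suc (upTo n)

IsSetComp : ℕ → SetComp → Set
IsSetComp n Φ = All (λ B → ¬ (B ≡ [])) Φ × All (Linked _<_) Φ × (concat Φ ↭ range n)

_==_ : SetComp → SetComp → Bool
Φ == Ψ = does (≡-dec (≡-dec _≟_) Φ Ψ)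

-- Words and ϱ.  A word a₁⋯aₙ is a list of natural numbers (variable indices).

-- positions (1-based) of the letter v in w
positions : ℕ → List ℕ → List ℕ
positions v w = map proj₁ (filterᵇ (λ p → proj₂ p ≡ᵇ v) (zip (range (length w)) w))

maxL : List ℕ → ℕ
maxL = foldr _⊔_ 0

-- ϱ(a): i lies in block |{a_l : a_l < a_i}| + 1
rho : List ℕ → SetComp
rho w = filterᵇ (λ B → not (null B)) (map (λ v → positions v w) (upTo (suc (maxL w))))

-- Elements of NCQSym (formal series in noncommuting variables) are given by
-- their coefficient functions on words; tensors by coefficients on pairs of words.

Series : Set
Series = List ℕ → ℕ

Tensor : Set
Tensor = List ℕ → List ℕ → ℕ

M : SetComp → Series
M Φ w = if rho w == Φ then 1 else 0

_⋆_ : Series → Series → Series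
(f ⋆ g) w = sum (map (λ i → f (take i w) * g (drop i w)) (upTo (suc (length w))))

_⊗_ : Series → Series → Tensor
(f ⊗ g) u v = f u * g v

insert : ℕ → List ℕ → List ℕ
insert x [] = x ∷ []
insert x (y ∷ ys) = if x ≤ᵇ y then x ∷ y ∷ ys else y ∷ insert x ys

sortℕ : List ℕ → List ℕ
sortℕ = foldr insert []

minB : Block → ℕ
minB [] = 0
minB (x ∷ _) = x

_>D_ : Block → Block → Bool
A >D B = (length B <ᵇ length A) ∨ ((length A ≡ᵇ length B) ∧ (minB A <ᵇ minB B))

-- An LDD filling is recorded as its list of columns (left to right), each
-- column being the list of blocks placed in it (top to bottom).
Filling : Set
Filling = List (List Block)

joinFirst : Block → Filling → Filling
joinFirst B [] = (B ∷ []) ∷ []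
joinFirst B (c ∷ cs) = (B ∷ c) ∷ cs

LDD : SetComp → List Filling
LDD [] = [] ∷ []
LDD (B ∷ []) = ((B ∷ []) ∷ []) ∷ []
LDD (B ∷ B′ ∷ rest) =
  map (λ F → (B ∷ []) ∷ F) (LDD (B′ ∷ rest))
  ++ (if B >D B′ then map (joinFirst B) (LDD (B′ ∷ rest)) else [])

col : Filling → SetComp
col F = map (λ c → sortℕ (concat c)) F

P : SetComp → Series
P Φ w = sum (map (λ F → M (col F) w) (LDD Φ))

shuffle : SetComp → SetComp → List SetComp
shuffle [] Ψ = Ψ ∷ []
shuffle (B ∷ Φ) [] = (B ∷ Φ) ∷ []
shuffle (B ∷ Φ) (A ∷ Ψ) =
  map (B ∷_) (shuffle Φ (A ∷ Ψ)) ++ map (A ∷_) (shuffle (B ∷ Φ) Ψ)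

_↑_ : SetComp → ℕ → SetComp
Ψ ↑ n = map (map (n +_)) Ψ

st : SetComp → SetComp
st Φ = map (map (λ x → length (filterᵇ (λ y → y ≤ᵇ x) (concat Φ)))) Φ

ΔM : SetComp → Tensor
ΔM Φ u v = sum (map (λ i → (M (st (take i Φ)) ⊗ M (st (drop i Φ))) u v) (upTo (suc (length Φ))))

ΔP : SetComp → Tensor
ΔP Φ u v = sum (map (λ F → ΔM (col F) u v) (LDD Φ))

{-# OPTIONS --safe #-}
-- The coefficient of a word w in P_Φ is 0 or 1: it is 1 exactly when w has length n, the letters
-- of w are constant on each block of Φ, and they weakly increase along Φ, two consecutive blocks
-- carrying the same letter only when the first is >D̃-larger. Indeed M_X picks out the words whose
-- level sets, listed by increasing letter, are X, and an LDD filling of Φ groups precisely such runs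
-- of equal letters into columns. With this description the product formula is about interleavings:
-- a factorisation w = uv contributes to P_Φ P_Ψ iff u and v are admissible for Φ and Ψ↑n, and since
-- the order on blocks is total on blocks with distinct minima, exactly one shuffle of Φ and Ψ↑n is
-- then admissible for w. For the coproduct, cutting an LDD filling of Φ between two columns gives
-- LDD fillings of a prefix and a suffix of Φ, each such pair arising from exactly one cut, and
-- standardisation commutes with taking LDD fillings since it preserves sizes and the order of minima.

module Submission where

open import Defs
open import Data.Bool using (Bool; true; false; T; if_then_else_; _∧_; _∨_; not)
open import Data.Bool.Properties using (T-∧; T-∨; T-≡; ∧-assoc; ∧-zeroʳ)
open import Data.Empty using (⊥; ⊥-elim)
open import Data.Maybe using (Maybe; just; nothing)
open import Data.Nat using (_≟_; ℕ; zero; suc; _+_; _*_; _∸_; _<_; _≤_; _≤ᵇ_; _<ᵇ_; _≡ᵇ_; z≤n; s≤s)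
open import Data.Nat.Properties
open import Algebra.Properties.CommutativeSemigroup +-commutativeSemigroup using () renaming (interchange to +-interchange)
open import Algebra.Properties.CommutativeSemigroup *-commutativeSemigroup using () renaming (interchange to *-interchange)
open import Data.Nat.ListAction using (sum)
open import Data.Nat.ListAction.Properties using (sum-++; sum-↭)
open import Data.List using (List; []; _∷_; _++_; map; concat; length; filterᵇ; upTo; take; drop; applyUpTo; null; zip)
open import Data.Bool.ListAction using (all; and)
open import Data.List.Properties using (≡-dec; ∷-injectiveˡ; map-++; map-∘; map-cong; map-cong-local; map-upTo; map-applyUpTo; upTo-∷ʳ)
open import Data.List.Properties using (length-map; length-take; length-drop; take-map; drop-map; concat-map; concat-++; concat-concat; ++-conicalˡ; ++-identityʳ)
open import Data.List.Relation.Unary.All as All using (All; []; _∷_)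
open import Data.List.Relation.Unary.All.Properties using (all⁺; all⁻; ++⁻ˡ) renaming (map⁺ to All-map⁺; ++⁺ to All-++⁺; take⁺ to All-take⁺; drop⁺ to All-drop⁺)
open import Data.List.Relation.Unary.Any using (here; there)
open import Data.List.Relation.Unary.Linked as Linked using (Linked; []; [-]; _∷_)
open import Data.List.Relation.Unary.Linked.Properties using (applyUpTo⁺₂; Linked⇒All; Linked⇒AllPairs; AllPairs⇒Linked) renaming (map⁺ to Linked-map⁺)
open import Data.List.Relation.Unary.AllPairs as AllPairs using ([]; _∷_)
open import Data.List.Relation.Unary.Unique.Propositional using (Unique)
import Data.List.Relation.Binary.Permutation.Setoid.Properties as ↭ₛ
open import Data.List.Membership.Propositional using (_∈_; _∉_)
open import Data.List.Relation.Binary.Subset.Propositional using (_⊆_)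
open import Data.List.Membership.Propositional.Properties
open import Data.List.Relation.Binary.Permutation.Propositional using (_↭_; ↭⇒↭ₛ; module PermutationReasoning; ↭-refl; ↭-sym; ↭-trans; ↭-reflexive; prep; swap)
open import Data.List.Relation.Binary.Permutation.Propositional.Properties using (∈-resp-↭; All-resp-↭; shifts; ++⁺ˡ; ↭-empty-inv) renaming (++⁺ to ↭-++⁺; map⁺ to ↭-map⁺)
open import Data.Product using (_×_; _,_; proj₁; proj₂; ∃-syntax)
open import Data.Sum using (_⊎_; inj₁; inj₂)
open import Function using (_∘_; id; Equivalence)
open import Relation.Nullary using (¬_; yes; no)
open import Relation.Nullary.Decidable using (T?)
open import Relation.Binary.Definitions using (tri<; tri≈; tri>)
open import Relation.Binary.PropositionalEquality using (_≡_; _≢_; refl; sym; trans; cong; cong₂; subst; subst₂; setoid; module ≡-Reasoning)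


𝟙 : Bool → ℕ
𝟙 b = if b then 1 else 0

∑ : {A : Set} → List A → (A → ℕ) → ℕ
∑ xs f = sum (map f xs)

syntax ∑ xs (λ x → e) = ∑[ x ← xs ] e

𝟙-∧ : ∀ a b → 𝟙 (a ∧ b) ≡ 𝟙 a * 𝟙 b
𝟙-∧ true b = sym (+-identityʳ (𝟙 b))
𝟙-∧ false b = refl

∑-++ : ∀ {A : Set} (xs ys : List A) f → ∑ (xs ++ ys) f ≡ ∑ xs f + ∑ ys f
∑-++ xs ys f = trans (cong sum (map-++ f xs ys)) (sum-++ (map f xs) (map f ys))

∑-cong : ∀ {A : Set} {f g : A → ℕ} xs → (∀ x → x ∈ xs → f x ≡ g x) → ∑ xs f ≡ ∑ xs g
∑-cong [] eq = refl
∑-cong (x ∷ xs) eq = cong₂ _+_ (eq x (here refl)) (∑-cong xs (λ y y∈ → eq y (there y∈)))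

∑-map : ∀ {A B : Set} (h : A → B) xs f → ∑ (map h xs) f ≡ ∑ xs (f ∘ h)
∑-map h [] f = refl
∑-map h (x ∷ xs) f = cong (f (h x) +_) (∑-map h xs f)

∑-*ˡ : ∀ {A : Set} c xs (f : A → ℕ) → ∑[ x ← xs ] (c * f x) ≡ c * ∑ xs f
∑-*ˡ c [] f = sym (*-zeroʳ c)
∑-*ˡ c (x ∷ xs) f = trans (cong (c * f x +_) (∑-*ˡ c xs f)) (sym (*-distribˡ-+ c (f x) _))

∑-*ʳ : ∀ {A : Set} c xs (f : A → ℕ) → ∑[ x ← xs ] (f x * c) ≡ ∑ xs f * c
∑-*ʳ c xs f = trans (∑-cong xs (λ x _ → *-comm (f x) c)) (trans (∑-*ˡ c xs f) (*-comm c _))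

∑-+ : ∀ {A : Set} xs (f g : A → ℕ) → ∑[ x ← xs ] (f x + g x) ≡ ∑ xs f + ∑ xs g
∑-+ [] f g = refl
∑-+ (x ∷ xs) f g = trans (cong (f x + g x +_) (∑-+ xs f g)) (+-interchange (f x) (g x) _ _)

∑-linear : ∀ {A : Set} c xs (f g : A → ℕ) → ∑[ x ← xs ] (f x + c * g x) ≡ ∑ xs f + c * ∑ xs g
∑-linear c [] f g = sym (*-zeroʳ c)
∑-linear c (x ∷ xs) f g = begin
  f x + c * g x + ∑[ y ← xs ] (f y + c * g y)  ≡⟨ cong (f x + c * g x +_) (∑-linear c xs f g) ⟩
  f x + c * g x + (∑ xs f + c * ∑ xs g)        ≡⟨ +-interchange (f x) (c * g x) (∑ xs f) (c * ∑ xs g) ⟩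
  f x + ∑ xs f + (c * g x + c * ∑ xs g)        ≡⟨ cong (f x + ∑ xs f +_) (sym (*-distribˡ-+ c (g x) (∑ xs g))) ⟩
  f x + ∑ xs f + c * (g x + ∑ xs g)            ∎
  where open ≡-Reasoning

∑-scale-+ : ∀ {A : Set} a d b xs (f : A → ℕ) → ∑[ x ← xs ] (a * f x) + d * ∑[ x ← xs ] (b * f x) ≡ (a + d * b) * ∑ xs f
∑-scale-+ a d b xs f = begin
  ∑[ x ← xs ] (a * f x) + d * ∑[ x ← xs ] (b * f x)  ≡⟨ cong₂ (λ u v → u + d * v) (∑-*ˡ a xs f) (∑-*ˡ b xs f) ⟩
  a * ∑ xs f + d * (b * ∑ xs f)                      ≡⟨ cong (a * ∑ xs f +_) (sym (*-assoc d b (∑ xs f))) ⟩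
  a * ∑ xs f + d * b * ∑ xs f                        ≡⟨ sym (*-distribʳ-+ (∑ xs f) a (d * b)) ⟩
  (a + d * b) * ∑ xs f                               ∎
  where open ≡-Reasoning

∑-if : ∀ {A : Set} d (xs : List A) f → ∑ (if d then xs else []) f ≡ 𝟙 d * ∑ xs f
∑-if true xs f = sym (+-identityʳ (∑ xs f))
∑-if false xs f = refl

∑-upTo-suc : ∀ n (f : ℕ → ℕ) → ∑ (upTo (suc n)) f ≡ f 0 + ∑ (upTo n) (f ∘ suc)
∑-upTo-suc n f = cong (λ xs → f 0 + sum xs) (trans (map-applyUpTo suc f n) (sym (map-upTo (f ∘ suc) n)))

∑-upTo-∷ʳ : ∀ K (f : ℕ → ℕ) → ∑ (upTo (suc K)) f ≡ ∑ (upTo K) f + f K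
∑-upTo-∷ʳ K f = begin
  ∑ (upTo (suc K)) f            ≡⟨ cong (λ xs → ∑ xs f) (sym (upTo-∷ʳ K)) ⟩
  ∑ (upTo K ++ K ∷ []) f        ≡⟨ ∑-++ (upTo K) (K ∷ []) f ⟩
  ∑ (upTo K) f + (f K + 0)      ≡⟨ cong (∑ (upTo K) f +_) (+-identityʳ (f K)) ⟩
  ∑ (upTo K) f + f K            ∎
  where open ≡-Reasoning

∑-upTo-zero : ∀ K (f : ℕ → ℕ) → (∀ i → i < K → f i ≡ 0) → ∑ (upTo K) f ≡ 0
∑-upTo-zero zero f _ = refl
∑-upTo-zero (suc K) f zeros =
  trans (∑-upTo-∷ʳ K f) (cong₂ _+_ (∑-upTo-zero K f (λ i i<K → zeros i (m<n⇒m<1+n i<K))) (zeros K ≤-refl))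

∑-upTo-single : ∀ K (f : ℕ → ℕ) n → n < K → (∀ i → i < K → i ≢ n → f i ≡ 0) → ∑ (upTo K) f ≡ f n
∑-upTo-single (suc K) f n n<1+K zeros with n ≟ K
... | yes refl = trans (∑-upTo-∷ʳ n f)
  (cong (_+ f n) (∑-upTo-zero n f (λ i i<n → zeros i (m<n⇒m<1+n i<n) (<⇒≢ i<n))))
... | no n≢K = trans (∑-upTo-∷ʳ K f)
  (trans (cong₂ _+_ (∑-upTo-single K f n (≤∧≢⇒< (≤-pred n<1+K) n≢K) (λ i i<K → zeros i (m<n⇒m<1+n i<K)))
                    (zeros K ≤-refl (n≢K ∘ sym)))
         (+-identityʳ (f n)))


bool-ext : ∀ {a b} → (T a → T b) → (T b → T a) → a ≡ b
bool-ext {true} {true} _ _ = refl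
bool-ext {true} {false} to _ = ⊥-elim (to _)
bool-ext {false} {true} _ from = ⊥-elim (from _)
bool-ext {false} {false} _ _ = refl

T-∧⁻ : ∀ {a b} → T (a ∧ b) → T a × T b
T-∧⁻ = Equivalence.to T-∧

T-∧⁺ : ∀ {a b} → T a → T b → T (a ∧ b)
T-∧⁺ ta tb = Equivalence.from T-∧ (ta , tb)

≡⇒≡ᵇ-true : ∀ {a b} → a ≡ b → (a ≡ᵇ b) ≡ true
≡⇒≡ᵇ-true {a} {b} a≡b = Equivalence.to T-≡ (≡⇒≡ᵇ a b a≡b)

≢⇒≡ᵇ-false : ∀ {a b} → a ≢ b → (a ≡ᵇ b) ≡ false
≢⇒≡ᵇ-false {a} {b} a≢b with a ≡ᵇ b in a≡ᵇb
... | true = ⊥-elim (a≢b (≡ᵇ⇒≡ a b (subst T (sym a≡ᵇb) _)))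
... | false = refl

≰⇒≤ᵇ-false : ∀ {a b} → ¬ a ≤ b → (a ≤ᵇ b) ≡ false
≰⇒≤ᵇ-false {a} {b} a≰b with a ≤ᵇ b in a≤ᵇb
... | true = ⊥-elim (a≰b (≤ᵇ⇒≤ a b (subst T (sym a≤ᵇb) _)))
... | false = refl

∧-left-comm : ∀ a b c → a ∧ (b ∧ c) ≡ b ∧ (a ∧ c)
∧-left-comm true b c = refl
∧-left-comm false true c = refl
∧-left-comm false false c = refl

∧-cong-when : ∀ c {a b} → (T c → a ≡ b) → c ∧ a ≡ c ∧ b
∧-cong-when true a≡b = a≡b _
∧-cong-when false _ = refl

∧-cong-between : ∀ c a b g → (T c → T g → a ≡ b) → c ∧ (a ∧ g) ≡ c ∧ (b ∧ g)
∧-cong-between true a b true a≡b = cong (_∧ true) (a≡b _ _)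
∧-cong-between true a b false _ = trans (∧-zeroʳ a) (sym (∧-zeroʳ b))
∧-cong-between false a b g _ = refl

∧-regroup : ∀ x y e z → ((x ∧ y) ∧ e) ∧ z ≡ (x ∧ e) ∧ (y ∧ z)
∧-regroup false y e z = refl
∧-regroup true true e z = refl
∧-regroup true false true z = refl
∧-regroup true false false z = refl

all-↭ : ∀ {A : Set} (g : A → Bool) {xs ys} → xs ↭ ys → all g xs ≡ all g ys
all-↭ g {xs} {ys} p = bool-ext (all⁻ g ∘ All-resp-↭ p ∘ all⁺ g xs) (all⁻ g ∘ All-resp-↭ (↭-sym p) ∘ all⁺ g ys)

all-++ : ∀ {A : Set} (g : A → Bool) xs ys → all g (xs ++ ys) ≡ all g xs ∧ all g ys
all-++ g [] ys = refl
all-++ g (x ∷ xs) ys = trans (cong (g x ∧_) (all-++ g xs ys)) (sym (∧-assoc (g x) _ _))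

all-cong : ∀ {A : Set} {g g′ : A → Bool} xs → (∀ {x} → x ∈ xs → g x ≡ g′ x) → all g xs ≡ all g′ xs
all-cong xs eq = cong and (map-cong-local (All.tabulate eq))


∈-if⁻ : ∀ {A : Set} d {x : A} {xs} → x ∈ (if d then xs else []) → x ∈ xs
∈-if⁻ true x∈ = x∈

minB∈ : ∀ {B : Block} → B ≢ [] → minB B ∈ B
minB∈ {[]} B≢[] = ⊥-elim (B≢[] refl)
minB∈ {b ∷ B} _ = here refl

map-nonempty : ∀ (h : ℕ → ℕ) {B} → B ≢ [] → map h B ≢ []
map-nonempty h {[]} B≢[] = ⊥-elim (B≢[] refl)
map-nonempty h {b ∷ B} _ ()

concat-↭ : ∀ {Xs Ys : List (List ℕ)} → Xs ↭ Ys → concat Xs ↭ concat Ys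
concat-↭ _↭_.refl = ↭-refl
concat-↭ (prep X p) = ++⁺ˡ X (concat-↭ p)
concat-↭ (swap X Y p) = ↭-trans (shifts X Y) (++⁺ˡ Y (++⁺ˡ X (concat-↭ p)))
concat-↭ (_↭_.trans p q) = ↭-trans (concat-↭ p) (concat-↭ q)

Unique-resp-↭ : ∀ {xs ys : List ℕ} → xs ↭ ys → Unique xs → Unique ys
Unique-resp-↭ p = ↭ₛ.Unique-resp-↭ (setoid ℕ) (↭⇒↭ₛ p)

Unique-++⁻ : ∀ (xs : List ℕ) {ys} → Unique (xs ++ ys) → Unique xs × Unique ys
Unique-++⁻ [] u = [] , u
Unique-++⁻ (x ∷ xs) (x∉ ∷ u) = (++⁻ˡ xs x∉ ∷ proj₁ (Unique-++⁻ xs u)) , proj₂ (Unique-++⁻ xs u)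

Unique-concat⁻ : ∀ {xss : List (List ℕ)} {xs} → Unique (concat xss) → xs ∈ xss → Unique xs
Unique-concat⁻ {xs ∷ xss} u (here refl) = proj₁ (Unique-++⁻ xs u)
Unique-concat⁻ {ys ∷ xss} u (there xs∈) = Unique-concat⁻ (proj₂ (Unique-++⁻ ys u)) xs∈

Linked⇒Unique : ∀ {xs} → Linked _<_ xs → Unique xs
Linked⇒Unique xs↗ = AllPairs.map <⇒≢ (Linked⇒AllPairs <-trans xs↗)

Linked-head : ∀ {x xs} → Linked _<_ (x ∷ xs) → All (x <_) xs
Linked-head [-] = []
Linked-head (x<y ∷ ys↗) = Linked⇒All <-trans x<y ys↗

sorted-tail-⊆ : ∀ {x y xs ys} → Linked _<_ (x ∷ xs) → x ≡ y → x ∷ xs ⊆ y ∷ ys → xs ⊆ ys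
sorted-tail-⊆ xs↗ x≡y sub p∈ with sub (there p∈)
... | here refl = ⊥-elim (<-irrefl x≡y (All.lookup (Linked-head xs↗) p∈))
... | there p∈ys = p∈ys

sorted-unique : ∀ {xs ys} → Linked _<_ xs → Linked _<_ ys → xs ⊆ ys → ys ⊆ xs → xs ≡ ys
sorted-unique {[]} {[]} _ _ _ _ = refl
sorted-unique {[]} {y ∷ ys} _ _ _ sup with sup (here refl)
... | ()
sorted-unique {x ∷ xs} {[]} _ _ sub _ with sub (here refl)
... | ()
sorted-unique {x ∷ xs} {y ∷ ys} xs↗ ys↗ sub sup =
  cong₂ _∷_ x≡y (sorted-unique (Linked.tail xs↗) (Linked.tail ys↗)
                  (sorted-tail-⊆ xs↗ x≡y sub) (sorted-tail-⊆ ys↗ (sym x≡y) sup))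
  where
  x≡y : x ≡ y
  x≡y with sub (here refl) | sup (here refl)
  ... | here x≡y | _ = x≡y
  ... | there _ | here y≡x = sym y≡x
  ... | there x∈ | there y∈ = ⊥-elim (<-asym (All.lookup (Linked-head ys↗) x∈) (All.lookup (Linked-head xs↗) y∈))

insert-↭ : ∀ x xs → insert x xs ↭ x ∷ xs
insert-↭ x [] = ↭-refl
insert-↭ x (y ∷ ys) with x ≤ᵇ y
... | true = ↭-refl
... | false = ↭-trans (prep y (insert-↭ x ys)) (swap y x ↭-refl)

sortℕ-↭ : ∀ xs → sortℕ xs ↭ xs
sortℕ-↭ [] = ↭-refl
sortℕ-↭ (x ∷ xs) = ↭-trans (insert-↭ x (sortℕ xs)) (prep x (sortℕ-↭ xs))

insert-sorted : ∀ x xs → Linked _<_ xs → x ∉ xs → Linked _<_ (insert x xs)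
insert-sorted x [] _ _ = [-]
insert-sorted x (y ∷ ys) ys↗ x∉ with x ≤ᵇ y in x≤ᵇy
... | true = ≤∧≢⇒< (≤ᵇ⇒≤ x y (subst T (sym x≤ᵇy) _)) (x∉ ∘ here) ∷ ys↗
... | false = AllPairs⇒Linked (All-resp-↭ (↭-sym (insert-↭ x ys)) (y<x ∷ Linked-head ys↗)
                               ∷ Linked⇒AllPairs <-trans (insert-sorted x ys (Linked.tail ys↗) (x∉ ∘ there)))
  where
  y<x : y < x
  y<x = ≰⇒> (λ x≤y → subst T x≤ᵇy (≤⇒≤ᵇ x≤y))

sortℕ-sorted : ∀ {xs} → Unique xs → Linked _<_ (sortℕ xs)
sortℕ-sorted {[]} _ = []
sortℕ-sorted {x ∷ xs} (x∉ ∷ u) =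
  insert-sorted x (sortℕ xs) (sortℕ-sorted u) (λ x∈ → All.lookup x∉ (∈-resp-↭ (sortℕ-↭ xs) x∈) refl)

insert-map : ∀ (g : ℕ → ℕ) x ys → (∀ {y} → y ∈ ys → (g x ≤ᵇ g y) ≡ (x ≤ᵇ y)) → insert (g x) (map g ys) ≡ map g (insert x ys)
insert-map g x [] _ = refl
insert-map g x (y ∷ ys) pres rewrite pres (here refl) with x ≤ᵇ y
... | true = refl
... | false = cong (g y ∷_) (insert-map g x ys (pres ∘ there))

sortℕ-map : ∀ (g : ℕ → ℕ) xs → (∀ {a b} → a ∈ xs → b ∈ xs → (g a ≤ᵇ g b) ≡ (a ≤ᵇ b)) → sortℕ (map g xs) ≡ map g (sortℕ xs)
sortℕ-map g [] _ = refl
sortℕ-map g (x ∷ xs) pres = trans (cong (insert (g x)) (sortℕ-map g xs (λ a∈ b∈ → pres (there a∈) (there b∈))))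
  (insert-map g x (sortℕ xs) (λ y∈ → pres (here refl) (there (∈-resp-↭ (sortℕ-↭ xs) y∈))))

∈-range⁻ : ∀ {n p} → p ∈ range n → ∃[ i ] (i < n × p ≡ suc i)
∈-range⁻ p∈ with ∈-map⁻ suc p∈
... | j , j∈ , refl with ∈-applyUpTo⁻ id j∈
...   | i , i<n , refl = i , i<n , refl

∈-range⁺ : ∀ {n i} → i < n → suc i ∈ range n
∈-range⁺ i<n = ∈-map⁺ suc (∈-applyUpTo⁺ id i<n)

range-sorted : ∀ n → Linked _<_ (range n)
range-sorted n = Linked-map⁺ (applyUpTo⁺₂ id n (λ i → s≤s (n<1+n i)))

range-⊆⇒≤ : ∀ {n m} → range n ⊆ range m → n ≤ m
range-⊆⇒≤ {zero} _ = z≤n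
range-⊆⇒≤ {suc n} sub with ∈-range⁻ (sub (∈-range⁺ (n<1+n n)))
... | i , i<m , refl = i<m

applyUpTo-+ : ∀ (f : ℕ → ℕ) n m → applyUpTo f (n + m) ≡ applyUpTo f n ++ applyUpTo (f ∘ (n +_)) m
applyUpTo-+ f zero m = refl
applyUpTo-+ f (suc n) m = cong (f 0 ∷_) (applyUpTo-+ (f ∘ suc) n m)

range-+ : ∀ n m → range (n + m) ≡ range n ++ map (n +_) (range m)
range-+ n m = begin
  map suc (upTo (n + m))                            ≡⟨ map-upTo suc (n + m) ⟩
  applyUpTo suc (n + m)                             ≡⟨ applyUpTo-+ suc n m ⟩
  applyUpTo suc n ++ applyUpTo (suc ∘ (n +_)) m     ≡⟨ cong₂ _++_ (sym (map-upTo suc n)) (sym (map-upTo (suc ∘ (n +_)) m)) ⟩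
  range n ++ map (suc ∘ (n +_)) (upTo m)            ≡⟨ cong (range n ++_) (map-cong (λ i → sym (+-suc n i)) (upTo m)) ⟩
  range n ++ map ((n +_) ∘ suc) (upTo m)            ≡⟨ cong (range n ++_) (map-∘ (upTo m)) ⟩
  range n ++ map (n +_) (range m)                   ∎
  where open ≡-Reasoning

setComp-⊆-range : ∀ {n X} → IsSetComp n X → concat X ⊆ range n
setComp-⊆-range (_ , _ , X↭[n]) = ∈-resp-↭ X↭[n]

range-⊆-setComp : ∀ {n X} → IsSetComp n X → range n ⊆ concat X
range-⊆-setComp (_ , _ , X↭[n]) = ∈-resp-↭ (↭-sym X↭[n])

setComp-minB : ∀ {n X B} → IsSetComp n X → B ∈ X → 1 ≤ minB B × minB B ≤ n
setComp-minB {n} X∈SC@(X-nonempty , _ , _) B∈ with ∈-range⁻ (setComp-⊆-range X∈SC (∈-concat⁺′ (minB∈ (All.lookup X-nonempty B∈)) B∈))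
... | i , i<n , p≡ = subst (1 ≤_) (sym p≡) (s≤s z≤n) , subst (_≤ n) (sym p≡) i<n


-- Chains and shuffles

above : {A : Set} → (A → A → Bool) → Maybe A → A → Bool
above R nothing x = true
above R (just z) x = R z x

chain : {A : Set} → (A → A → Bool) → Maybe A → List A → Bool
chain R m [] = true
chain R m (x ∷ xs) = above R m x ∧ chain R (just x) xs

chain-unbounded : ∀ {A : Set} (R : A → A → Bool) z xs → T (chain R (just z) xs) → T (chain R nothing xs)
chain-unbounded R z [] _ = _
chain-unbounded R z (x ∷ xs) t = proj₂ (T-∧⁻ {R z x} t)

chain-map : ∀ {A B : Set} (R : B → B → Bool) (h : A → B) m xs →
            chain R (Data.Maybe.map h m) (map h xs) ≡ chain (λ a b → R (h a) (h b)) m xs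
chain-map R h nothing [] = refl
chain-map R h nothing (x ∷ xs) = chain-map R h (just x) xs
chain-map R h (just z) [] = refl
chain-map R h (just z) (x ∷ xs) = cong (R (h z) (h x) ∧_) (chain-map R h (just x) xs)

chain-cong : ∀ {A : Set} {R R′ : A → A → Bool} (Good : A → Set) → (∀ {a b} → Good a → Good b → R a b ≡ R′ a b) →
             ∀ m xs → All Good xs → (∀ {z} → m ≡ just z → Good z) → chain R m xs ≡ chain R′ m xs
chain-cong Good R≡R′ m [] _ _ = refl
chain-cong Good R≡R′ nothing (x ∷ xs) (gx ∷ gxs) _ = chain-cong Good R≡R′ (just x) xs gxs (λ { refl → gx })
chain-cong Good R≡R′ (just z) (x ∷ xs) (gx ∷ gxs) gm =
  cong₂ _∧_ (R≡R′ (gm refl) gx) (chain-cong Good R≡R′ (just x) xs gxs (λ { refl → gx }))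

∑-chain-∷ : ∀ (R : Block → Block → Bool) m C (Γs : List SetComp) →
            ∑[ Γ ← map (C ∷_) Γs ] 𝟙 (chain R m Γ) ≡ 𝟙 (above R m C) * ∑[ Γ ← Γs ] 𝟙 (chain R (just C) Γ)
∑-chain-∷ R m C Γs = trans (∑-map (C ∷_) Γs _)
  (trans (∑-cong Γs (λ Γ _ → 𝟙-∧ (above R m C) (chain R (just C) Γ))) (∑-*ˡ (𝟙 (above R m C)) Γs _))

interleave-count : ∀ a b r x y → (T a → T r → T b) → (T b → T (not r) → T a) →
  𝟙 a * (𝟙 x * 𝟙 (r ∧ y)) + 𝟙 b * (𝟙 (not r ∧ x) * 𝟙 y) ≡ 𝟙 (a ∧ x) * 𝟙 (b ∧ y)
interleave-count false false r x y _ _ = refl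
interleave-count true true true x y _ _ = trans (+-identityʳ _) (+-identityʳ _)
interleave-count true true false x y _ _ = cong₂ _+_ (trans (+-identityʳ _) (*-zeroʳ (𝟙 x))) (+-identityʳ _)
interleave-count true false true x y a→b _ = ⊥-elim (a→b _ _)
interleave-count true false false x y _ _ = trans (+-identityʳ _) (+-identityʳ _)
interleave-count false true true x y _ _ = refl
interleave-count false true false x y _ b→a = ⊥-elim (b→a _ _)

-- Exactly one of R B A and R A B holds, and by transitivity the head coming first passes the bound m
-- on to the other, so only the shuffles starting with the R-smaller head can be chains.
∑-shuffle-chain : ∀ (R : Block → Block → Bool) → (∀ {a b c} → T (R a b) → T (R b c) → T (R a c)) →
  ∀ m X Y → (∀ {x y} → x ∈ X → y ∈ Y → R y x ≡ not (R x y)) →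
  ∑[ Γ ← shuffle X Y ] 𝟙 (chain R m Γ) ≡ 𝟙 (chain R m X) * 𝟙 (chain R m Y)
∑-shuffle-chain R R-trans m [] Y _ = refl
∑-shuffle-chain R R-trans m (B ∷ X) [] _ = trans (+-identityʳ _) (sym (*-identityʳ _))
∑-shuffle-chain R R-trans m (B ∷ X) (A ∷ Y) flip = begin
  ∑ (map (B ∷_) S₁ ++ map (A ∷_) S₂) h
    ≡⟨ ∑-++ (map (B ∷_) S₁) (map (A ∷_) S₂) h ⟩
  ∑ (map (B ∷_) S₁) h + ∑ (map (A ∷_) S₂) h
    ≡⟨ cong₂ _+_ (∑-chain-∷ R m B S₁) (∑-chain-∷ R m A S₂) ⟩
  𝟙 a * ∑[ Γ ← S₁ ] 𝟙 (chain R (just B) Γ) + 𝟙 b * ∑[ Γ ← S₂ ] 𝟙 (chain R (just A) Γ)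
    ≡⟨ cong₂ _+_ (cong (𝟙 a *_) (∑-shuffle-chain R R-trans (just B) X (A ∷ Y) (flip ∘ there)))
                 (cong (𝟙 b *_) (∑-shuffle-chain R R-trans (just A) (B ∷ X) Y (λ x∈ y∈ → flip x∈ (there y∈)))) ⟩
  𝟙 a * (𝟙 x * 𝟙 (R B A ∧ y)) + 𝟙 b * (𝟙 (R A B ∧ x) * 𝟙 y)
    ≡⟨ cong (λ r → 𝟙 a * (𝟙 x * 𝟙 (R B A ∧ y)) + 𝟙 b * (𝟙 (r ∧ x) * 𝟙 y)) (flip (here refl) (here refl)) ⟩
  𝟙 a * (𝟙 x * 𝟙 (R B A ∧ y)) + 𝟙 b * (𝟙 (not (R B A) ∧ x) * 𝟙 y)
    ≡⟨ interleave-count a b (R B A) x y (above-trans m) (λ tb tr → above-trans m tb (subst T (sym (flip (here refl) (here refl))) tr)) ⟩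
  𝟙 (a ∧ x) * 𝟙 (b ∧ y) ∎
  where
  open ≡-Reasoning
  S₁ = shuffle X (A ∷ Y)
  S₂ = shuffle (B ∷ X) Y
  h : SetComp → ℕ
  h Γ = 𝟙 (chain R m Γ)
  a = above R m B
  b = above R m A
  x = chain R (just B) X
  y = chain R (just A) Y
  above-trans : ∀ m {C D} → T (above R m C) → T (R C D) → T (above R m D)
  above-trans nothing _ _ = _
  above-trans (just z) zC CD = R-trans zC CD

shuffle-↭ : ∀ X Y {Γ} → Γ ∈ shuffle X Y → Γ ↭ X ++ Y
shuffle-↭ [] Y (here refl) = ↭-refl
shuffle-↭ (B ∷ X) [] (here refl) = ↭-reflexive (sym (++-identityʳ (B ∷ X)))
shuffle-↭ (B ∷ X) (A ∷ Y) Γ∈ with ∈-++⁻ (map (B ∷_) (shuffle X (A ∷ Y))) Γ∈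
... | inj₁ Γ∈₁ with ∈-map⁻ (B ∷_) Γ∈₁
...   | Γ′ , Γ′∈ , refl = prep B (shuffle-↭ X (A ∷ Y) Γ′∈)
shuffle-↭ (B ∷ X) (A ∷ Y) Γ∈ | inj₂ Γ∈₂ with ∈-map⁻ (A ∷_) Γ∈₂
...   | Γ′ , Γ′∈ , refl = ↭-trans (prep A (shuffle-↭ (B ∷ X) Y Γ′∈)) (↭-sym (shifts (B ∷ X) (A ∷ [])))

shuffle-setComp : ∀ {n m Φ Ψ Γ} → IsSetComp n Φ → IsSetComp m Ψ → Γ ∈ shuffle Φ (Ψ ↑ n) → IsSetComp (n + m) Γ
shuffle-setComp {n} {m} {Φ} {Ψ} {Γ} (Φ-nonempty , Φ-sorted , Φ↭[n]) (Ψ-nonempty , Ψ-sorted , Ψ↭[m]) Γ∈ =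
  All-resp-↭ (↭-sym Γ↭) (All-++⁺ Φ-nonempty (All-map⁺ (All.map (map-nonempty (n +_)) Ψ-nonempty))) ,
  All-resp-↭ (↭-sym Γ↭) (All-++⁺ Φ-sorted (All-map⁺ (All.map (Linked-map⁺ ∘ Linked.map (+-monoʳ-< n)) Ψ-sorted))) ,
  (begin
    concat Γ                              ↭⟨ concat-↭ Γ↭ ⟩
    concat (Φ ++ Ψ ↑ n)                   ≡⟨ sym (concat-++ Φ (Ψ ↑ n)) ⟩
    concat Φ ++ concat (Ψ ↑ n)            ≡⟨ cong (concat Φ ++_) (concat-map Ψ) ⟩
    concat Φ ++ map (n +_) (concat Ψ)     ↭⟨ ↭-++⁺ Φ↭[n] (↭-map⁺ (n +_) Ψ↭[m]) ⟩
    range n ++ map (n +_) (range m)       ≡⟨ sym (range-+ n m) ⟩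
    range (n + m)                         ∎)
  where
  open PermutationReasoning
  Γ↭ = shuffle-↭ Φ (Ψ ↑ n) Γ∈

shuffle-distinct : ∀ {n m Φ Ψ} → IsSetComp n Φ → IsSetComp m Ψ → ∀ {x y} → x ∈ Φ → y ∈ Ψ ↑ n → minB x ≢ minB y
shuffle-distinct {n} Φ∈SC Ψ∈SC x∈ y∈ with ∈-map⁻ (map (n +_)) y∈
... | y′ , y′∈ , refl with y′ | All.lookup (proj₁ Ψ∈SC) y′∈ | setComp-minB Ψ∈SC y′∈
...   | [] | y′≢[] | _ = ⊥-elim (y′≢[] refl)
...   | b ∷ _ | _ | 1≤b , _ = λ x≡ → <-irrefl x≡ (≤-<-trans (proj₂ (setComp-minB Φ∈SC x∈)) (m<m+n n 1≤b))


-- Blocks labelled by the letters of a word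

value : (ℕ → ℕ) → Block → ℕ
value f B = f (minB B)

constantOn : (ℕ → ℕ) → Block → Bool
constantOn f B = all (λ p → f p ≡ᵇ value f B) B

graded : (ℕ → ℕ) → (Block → Block → Bool) → SetComp → Bool
graded f R X = all (constantOn f) X ∧ chain R nothing X

valueBelow : (ℕ → ℕ) → Block → Block → Bool
valueBelow f A B = value f A <ᵇ value f B

-- Equal letters on consecutive blocks are allowed exactly where an LDD filling may put them in one column.
precedes : (ℕ → ℕ) → Block → Block → Bool
precedes f A B = (value f A <ᵇ value f B) ∨ ((value f A ≡ᵇ value f B) ∧ (A >D B))

admissible : (ℕ → ℕ) → SetComp → Bool
admissible f Φ = graded f (precedes f) Φ

constantOn⁻ : ∀ f B {p} → T (constantOn f B) → p ∈ B → f p ≡ value f B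
constantOn⁻ f B t p∈ = ≡ᵇ⇒≡ _ _ (All.lookup (all⁺ _ B t) p∈)

constantOn⁺ : ∀ f B c → (∀ {p} → p ∈ B → f p ≡ c) → T (constantOn f B)
constantOn⁺ f [] c _ = _
constantOn⁺ f (b ∷ B) c const = all⁻ _ (All.tabulate (λ p∈ → ≡⇒≡ᵇ _ _ (trans (const p∈) (sym (const (here refl))))))

constantOn-↭ : ∀ f {B C} → B ↭ C → constantOn f B ≡ constantOn f C
constantOn-↭ f {B} {C} B↭C = bool-ext
  (λ t → constantOn⁺ f C (value f B) (λ p∈ → constantOn⁻ f B t (∈-resp-↭ (↭-sym B↭C) p∈)))
  (λ t → constantOn⁺ f B (value f C) (λ p∈ → constantOn⁻ f C t (∈-resp-↭ B↭C p∈)))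

value-↭ : ∀ f {B C} → B ↭ C → T (constantOn f B) → value f C ≡ value f B
value-↭ f {B} {[]} B↭C _ with ↭-empty-inv B↭C
... | refl = refl
value-↭ f {B} {c ∷ C} B↭C t = constantOn⁻ f B t (∈-resp-↭ (↭-sym B↭C) (here refl))

constantOn-++ : ∀ f {A C} → A ≢ [] → C ≢ [] →
  constantOn f (A ++ C) ≡ (constantOn f A ∧ constantOn f C) ∧ (value f A ≡ᵇ value f C)
constantOn-++ f {[]} A≢[] _ = ⊥-elim (A≢[] refl)
constantOn-++ f {a ∷ A} {C} _ C≢[] = bool-ext to from
  where
  to : T (constantOn f (a ∷ A ++ C)) → T ((constantOn f (a ∷ A) ∧ constantOn f C) ∧ (f a ≡ᵇ value f C))
  to t = T-∧⁺ (T-∧⁺ (constantOn⁺ f (a ∷ A) (f a) (λ p∈ → constantOn⁻ f (a ∷ A ++ C) t (∈-++⁺ˡ p∈)))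
                    (constantOn⁺ f C (f a) (λ p∈ → constantOn⁻ f (a ∷ A ++ C) t (∈-++⁺ʳ (a ∷ A) p∈))))
              (≡⇒≡ᵇ _ _ (sym (constantOn⁻ f (a ∷ A ++ C) t (∈-++⁺ʳ (a ∷ A) (minB∈ C≢[])))))
  from : T ((constantOn f (a ∷ A) ∧ constantOn f C) ∧ (f a ≡ᵇ value f C)) → T (constantOn f (a ∷ A ++ C))
  from t with T-∧⁻ t
  ... | tAC , eq with T-∧⁻ {constantOn f (a ∷ A)} tAC
  ... | tA , tC = constantOn⁺ f (a ∷ A ++ C) (f a) on-union
    where
    on-union : ∀ {p} → p ∈ a ∷ A ++ C → f p ≡ f a
    on-union p∈ with ∈-++⁻ (a ∷ A) p∈
    ... | inj₁ p∈A = constantOn⁻ f (a ∷ A) tA p∈A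
    ... | inj₂ p∈C = trans (constantOn⁻ f C tC p∈C) (sym (≡ᵇ⇒≡ _ _ eq))

constantOn-map : ∀ f (h : ℕ → ℕ) B → constantOn f (map h B) ≡ constantOn (f ∘ h) B
constantOn-map f h [] = refl
constantOn-map f h (b ∷ B) = cong ((f (h b) ≡ᵇ f (h b)) ∧_) (go B)
  where
  go : ∀ B → all (λ p → f p ≡ᵇ f (h b)) (map h B) ≡ all (λ p → f (h p) ≡ᵇ f (h b)) B
  go [] = refl
  go (p ∷ B) = cong ((f (h p) ≡ᵇ f (h b)) ∧_) (go B)

constantOn-cong : ∀ {f g} B → (∀ {p} → p ∈ B → f p ≡ g p) → constantOn f B ≡ constantOn g B
constantOn-cong [] _ = refl
constantOn-cong {f} {g} (b ∷ B) agree = go (b ∷ B) (λ p∈ → p∈)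
  where
  go : ∀ C → (∀ {p} → p ∈ C → p ∈ b ∷ B) → all (λ p → f p ≡ᵇ f b) C ≡ all (λ p → g p ≡ᵇ g b) C
  go [] _ = refl
  go (p ∷ C) C⊆ = cong₂ _∧_ (cong₂ _≡ᵇ_ (agree (C⊆ (here refl))) (agree (here refl))) (go C (C⊆ ∘ there))

value-++ : ∀ f {B} C → B ≢ [] → value f (B ++ C) ≡ value f B
value-++ f {[]} C B≢[] = ⊥-elim (B≢[] refl)
value-++ f {b ∷ B} C _ = refl

constantOn-sortℕ : ∀ f xs → constantOn f (sortℕ xs) ≡ constantOn f xs
constantOn-sortℕ f xs = constantOn-↭ f (sortℕ-↭ xs)

value-sortℕ-++ : ∀ f {B} C → B ≢ [] → T (constantOn f (sortℕ (B ++ C))) → value f (sortℕ (B ++ C)) ≡ value f B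
value-sortℕ-++ f {[]} C B≢[] _ = ⊥-elim (B≢[] refl)
value-sortℕ-++ f {b ∷ B} C _ t = sym (value-↭ f (sortℕ-↭ (b ∷ B ++ C)) t)

graded-∷ : ∀ f R A X → graded f R (A ∷ X) ≡ constantOn f A ∧ (all (constantOn f) X ∧ chain R (just A) X)
graded-∷ f R A X = ∧-assoc (constantOn f A) (all (constantOn f) X) (chain R (just A) X)

graded-∷-∷ : ∀ f R A A′ X → graded f R (A ∷ A′ ∷ X) ≡ constantOn f A ∧ (R A A′ ∧ graded f R (A′ ∷ X))
graded-∷-∷ f R A A′ X = trans (graded-∷ f R A (A′ ∷ X))
  (cong (constantOn f A ∧_) (∧-left-comm (all (constantOn f) (A′ ∷ X)) (R A A′) (chain R (just A′) X)))

chain-valueBelow-head : ∀ f {z z′} X → value f z ≡ value f z′ →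
  chain (valueBelow f) (just z) X ≡ chain (valueBelow f) (just z′) X
chain-valueBelow-head f [] _ = refl
chain-valueBelow-head f (x ∷ X) z≡z′ = cong (λ v → (v <ᵇ value f x) ∧ chain (valueBelow f) (just x) X) z≡z′

admissible-cong : ∀ {f g} X → All (_≢ []) X → (∀ {p} → p ∈ concat X → f p ≡ g p) → admissible f X ≡ admissible g X
admissible-cong {f} {g} X X-nonempty agree = cong₂ _∧_
  (all-cong X (λ B∈ → constantOn-cong _ (λ p∈ → agree (∈-concat⁺′ p∈ B∈))))
  (chain-cong (λ A → value f A ≡ value g A) (λ {A} {B} vA vB → cong₂ (λ u v → (u <ᵇ v) ∨ ((u ≡ᵇ v) ∧ (A >D B))) vA vB)
              nothing X (All.tabulate (λ B∈ → agree (∈-concat⁺′ (minB∈ (All.lookup X-nonempty B∈)) B∈))) (λ ()))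

+-<ᵇ : ∀ n a b → (n + a <ᵇ n + b) ≡ (a <ᵇ b)
+-<ᵇ zero a b = refl
+-<ᵇ (suc n) a b = +-<ᵇ n a b

precedes-↑ : ∀ f n {A B} → A ≢ [] → B ≢ [] → precedes f (map (n +_) A) (map (n +_) B) ≡ precedes (f ∘ (n +_)) A B
precedes-↑ f n {[]} A≢[] _ = ⊥-elim (A≢[] refl)
precedes-↑ f n {a ∷ A} {[]} _ B≢[] = ⊥-elim (B≢[] refl)
precedes-↑ f n {a ∷ A} {b ∷ B} _ _ rewrite length-map (n +_) A | length-map (n +_) B | +-<ᵇ n a b = refl

admissible-↑ : ∀ f n Ψ → All (_≢ []) Ψ → admissible f (Ψ ↑ n) ≡ admissible (f ∘ (n +_)) Ψ
admissible-↑ f n Ψ Ψ-nonempty = cong₂ _∧_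
  (trans (cong and (sym (map-∘ Ψ))) (all-cong Ψ (λ {B} _ → constantOn-map f (n +_) B)))
  (trans (chain-map (precedes f) (map (n +_)) nothing Ψ)
         (chain-cong (_≢ []) (precedes-↑ f n) nothing Ψ Ψ-nonempty (λ ())))

data _⊏_ : ℕ × ℕ × ℕ → ℕ × ℕ × ℕ → Set where
  value< : ∀ {v l m v′ l′ m′} → v < v′ → (v , l , m) ⊏ (v′ , l′ , m′)
  size>  : ∀ {v l m l′ m′} → l′ < l → (v , l , m) ⊏ (v , l′ , m′)
  min<   : ∀ {v l m m′} → m < m′ → (v , l , m) ⊏ (v , l , m′)

⊏-trans : ∀ {x y z} → x ⊏ y → y ⊏ z → x ⊏ z
⊏-trans (value< p) (value< q) = value< (<-trans p q)
⊏-trans (value< p) (size> _) = value< p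
⊏-trans (value< p) (min< _) = value< p
⊏-trans (size> _) (value< q) = value< q
⊏-trans (size> p) (size> q) = size> (<-trans q p)
⊏-trans (size> p) (min< _) = size> p
⊏-trans (min< _) (value< q) = value< q
⊏-trans (min< _) (size> q) = size> q
⊏-trans (min< p) (min< q) = min< (<-trans p q)

⊏-irrefl : ∀ {x} → ¬ x ⊏ x
⊏-irrefl (value< p) = <-irrefl refl p
⊏-irrefl (size> p) = <-irrefl refl p
⊏-irrefl (min< p) = <-irrefl refl p

⊏-connex : ∀ v l m v′ l′ m′ → m ≢ m′ → (v , l , m) ⊏ (v′ , l′ , m′) ⊎ (v′ , l′ , m′) ⊏ (v , l , m)
⊏-connex v l m v′ l′ m′ m≢m′ with <-cmp v v′ | <-cmp l l′ | <-cmp m m′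
... | tri< v<v′ _ _ | _ | _ = inj₁ (value< v<v′)
... | tri> _ _ v′<v | _ | _ = inj₂ (value< v′<v)
... | tri≈ _ refl _ | tri< l<l′ _ _ | _ = inj₂ (size> l<l′)
... | tri≈ _ refl _ | tri> _ _ l′<l | _ = inj₁ (size> l′<l)
... | tri≈ _ refl _ | tri≈ _ refl _ | tri< m<m′ _ _ = inj₁ (min< m<m′)
... | tri≈ _ refl _ | tri≈ _ refl _ | tri> _ _ m′<m = inj₂ (min< m′<m)
... | tri≈ _ refl _ | tri≈ _ refl _ | tri≈ _ m≡m′ _ = ⊥-elim (m≢m′ m≡m′)

key : (ℕ → ℕ) → Block → ℕ × ℕ × ℕ
key f A = value f A , length A , minB A

lexᵇ⇒⊏ : ∀ v l m v′ l′ m′ → T ((v <ᵇ v′) ∨ ((v ≡ᵇ v′) ∧ ((l′ <ᵇ l) ∨ ((l ≡ᵇ l′) ∧ (m <ᵇ m′))))) →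
         (v , l , m) ⊏ (v′ , l′ , m′)
lexᵇ⇒⊏ v l m v′ l′ m′ t with Equivalence.to T-∨ t
... | inj₁ v< = value< (<ᵇ⇒< _ _ v<)
... | inj₂ t′ with T-∧⁻ t′
...   | v≡ , t″ with ≡ᵇ⇒≡ v v′ v≡ | Equivalence.to T-∨ t″
...     | refl | inj₁ l> = size> (<ᵇ⇒< _ _ l>)
...     | refl | inj₂ t‴ with T-∧⁻ t‴
...       | l≡ , m< with ≡ᵇ⇒≡ l l′ l≡
...         | refl = min< (<ᵇ⇒< _ _ m<)

⊏⇒lexᵇ : ∀ {v l m v′ l′ m′} → (v , l , m) ⊏ (v′ , l′ , m′) →
         T ((v <ᵇ v′) ∨ ((v ≡ᵇ v′) ∧ ((l′ <ᵇ l) ∨ ((l ≡ᵇ l′) ∧ (m <ᵇ m′)))))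
⊏⇒lexᵇ (value< v<) = Equivalence.from T-∨ (inj₁ (<⇒<ᵇ v<))
⊏⇒lexᵇ {v} (size> l>) = Equivalence.from T-∨ (inj₂ (T-∧⁺ (≡⇒≡ᵇ v v refl) (Equivalence.from T-∨ (inj₁ (<⇒<ᵇ l>)))))
⊏⇒lexᵇ {v} {l} (min< m<) =
  Equivalence.from T-∨ (inj₂ (T-∧⁺ (≡⇒≡ᵇ v v refl) (Equivalence.from T-∨ (inj₂ (T-∧⁺ (≡⇒≡ᵇ l l refl) (<⇒<ᵇ m<))))))

precedes⇒⊏ : ∀ f A B → T (precedes f A B) → key f A ⊏ key f B
precedes⇒⊏ f A B = lexᵇ⇒⊏ _ _ _ _ _ _

⊏⇒precedes : ∀ f A B → key f A ⊏ key f B → T (precedes f A B)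
⊏⇒precedes f A B = ⊏⇒lexᵇ

precedes-trans : ∀ f {A B C} → T (precedes f A B) → T (precedes f B C) → T (precedes f A C)
precedes-trans f {A} {B} {C} AB BC = ⊏⇒precedes f A C (⊏-trans (precedes⇒⊏ f A B AB) (precedes⇒⊏ f B C BC))

precedes-flip : ∀ f A B → minB A ≢ minB B → precedes f B A ≡ not (precedes f A B)
precedes-flip f A B m≢ with precedes f A B in AB
... | true = bool-ext (λ BA → ⊏-irrefl (⊏-trans (precedes⇒⊏ f A B (subst T (sym AB) _)) (precedes⇒⊏ f B A BA))) (λ ())
... | false = bool-ext (λ _ → _) (λ _ → either (⊏-connex _ _ _ _ _ _ m≢))
  where
  either : key f A ⊏ key f B ⊎ key f B ⊏ key f A → T (precedes f B A)
  either (inj₁ A⊏B) = ⊥-elim (subst T AB (⊏⇒precedes f A B A⊏B))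
  either (inj₂ B⊏A) = ⊏⇒precedes f B A B⊏A

∑-shuffle-admissible : ∀ f X Y → (∀ {x y} → x ∈ X → y ∈ Y → minB x ≢ minB y) →
  ∑[ Γ ← shuffle X Y ] 𝟙 (admissible f Γ) ≡ 𝟙 (admissible f X) * 𝟙 (admissible f Y)
∑-shuffle-admissible f X Y distinct = begin
  ∑[ Γ ← shuffle X Y ] 𝟙 (all c Γ ∧ chain ≺ nothing Γ)
    ≡⟨ ∑-cong (shuffle X Y) (λ Γ Γ∈ → trans (cong (λ a → 𝟙 (a ∧ chain ≺ nothing Γ)) (all-shuffle Γ∈))
                                            (𝟙-∧ (all c X ∧ all c Y) (chain ≺ nothing Γ))) ⟩
  ∑[ Γ ← shuffle X Y ] (𝟙 (all c X ∧ all c Y) * 𝟙 (chain ≺ nothing Γ))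
    ≡⟨ ∑-*ˡ (𝟙 (all c X ∧ all c Y)) (shuffle X Y) _ ⟩
  𝟙 (all c X ∧ all c Y) * ∑[ Γ ← shuffle X Y ] 𝟙 (chain ≺ nothing Γ)
    ≡⟨ cong₂ _*_ (𝟙-∧ (all c X) (all c Y))
                 (∑-shuffle-chain ≺ (λ {A} {B} {C} → precedes-trans f {A} {B} {C}) nothing X Y
                                  (λ {x} {y} x∈ y∈ → precedes-flip f x y (distinct x∈ y∈))) ⟩
  𝟙 (all c X) * 𝟙 (all c Y) * (𝟙 (chain ≺ nothing X) * 𝟙 (chain ≺ nothing Y))
    ≡⟨ *-interchange (𝟙 (all c X)) (𝟙 (all c Y)) _ _ ⟩
  𝟙 (all c X) * 𝟙 (chain ≺ nothing X) * (𝟙 (all c Y) * 𝟙 (chain ≺ nothing Y))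
    ≡⟨ sym (cong₂ _*_ (𝟙-∧ (all c X) _) (𝟙-∧ (all c Y) _)) ⟩
  𝟙 (graded f ≺ X) * 𝟙 (graded f ≺ Y) ∎
  where
  open ≡-Reasoning
  c = constantOn f
  ≺ = precedes f
  all-shuffle : ∀ {Γ} → Γ ∈ shuffle X Y → all c Γ ≡ all c X ∧ all c Y
  all-shuffle Γ∈ = trans (all-↭ c (shuffle-↭ X Y Γ∈)) (all-++ c X Y)


-- The monomial basis: ρ(w) is the sequence of level sets of w

at : List ℕ → ℕ → ℕ
at [] i = 0
at (a ∷ w) zero = a
at (a ∷ w) (suc i) = at w i

-- Positions are 1-based, as in ρ; position 0 and positions past the end get the junk letter 0.
letter : List ℕ → ℕ → ℕ
letter w zero = 0
letter w (suc i) = at w i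

occurrences : (ℕ → ℕ) → ℕ → List ℕ → List ℕ
occurrences g v [] = []
occurrences g v (a ∷ w) =
  if a ≡ᵇ v then g 0 ∷ occurrences (g ∘ suc) v w else occurrences (g ∘ suc) v w

positions≡occurrences : ∀ v w → positions v w ≡ occurrences suc v w
positions≡occurrences v w = trans (cong (λ ps → map proj₁ (filterᵇ (λ p → proj₂ p ≡ᵇ v) (zip ps w))) (map-upTo suc (length w)))
                                  (go suc w)
  where
  go : ∀ g w → map proj₁ (filterᵇ (λ p → proj₂ p ≡ᵇ v) (zip (applyUpTo g (length w)) w)) ≡ occurrences g v w
  go g [] = refl
  go g (a ∷ w) with a ≡ᵇ v
  ... | true = cong (g 0 ∷_) (go (g ∘ suc) w)
  ... | false = go (g ∘ suc) w

∈-occurrences⁻ : ∀ g v w {p} → p ∈ occurrences g v w → ∃[ i ] (i < length w × p ≡ g i × at w i ≡ v)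
∈-occurrences⁻ g v (a ∷ w) p∈ with a ≡ᵇ v in a≡ᵇv
∈-occurrences⁻ g v (a ∷ w) (here refl) | true = 0 , s≤s z≤n , refl , ≡ᵇ⇒≡ a v (subst T (sym a≡ᵇv) _)
∈-occurrences⁻ g v (a ∷ w) (there p∈) | true with ∈-occurrences⁻ (g ∘ suc) v w p∈
... | i , i< , p≡ , wᵢ≡v = suc i , s≤s i< , p≡ , wᵢ≡v
∈-occurrences⁻ g v (a ∷ w) p∈ | false with ∈-occurrences⁻ (g ∘ suc) v w p∈
... | i , i< , p≡ , wᵢ≡v = suc i , s≤s i< , p≡ , wᵢ≡v

∈-occurrences⁺ : ∀ g w {i} → i < length w → g i ∈ occurrences g (at w i) w
∈-occurrences⁺ g (a ∷ w) {zero} _ rewrite ≡⇒≡ᵇ-true {a} refl = here refl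
∈-occurrences⁺ g (a ∷ w) {suc i} (s≤s i<) with a ≡ᵇ at w i
... | true = there (∈-occurrences⁺ (g ∘ suc) w i<)
... | false = ∈-occurrences⁺ (g ∘ suc) w i<

occurrences-sorted : ∀ g v w → (∀ {i j} → i < j → g i < g j) → Linked _<_ (occurrences g v w)
occurrences-sorted g v [] _ = []
occurrences-sorted g v (a ∷ w) g↗ with a ≡ᵇ v
... | true = AllPairs⇒Linked (All.tabulate first-least ∷ Linked⇒AllPairs <-trans rest↗)
  where
  rest↗ = occurrences-sorted (g ∘ suc) v w (g↗ ∘ s≤s)
  first-least : ∀ {p} → p ∈ occurrences (g ∘ suc) v w → g 0 < p
  first-least p∈ with ∈-occurrences⁻ (g ∘ suc) v w p∈
  ... | _ , _ , refl , _ = g↗ (s≤s z≤n)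
... | false = occurrences-sorted (g ∘ suc) v w (g↗ ∘ s≤s)

letter-occurrences : ∀ w v {p} → p ∈ occurrences suc v w → letter w p ≡ v
letter-occurrences w v p∈ with ∈-occurrences⁻ suc v w p∈
... | _ , _ , refl , wᵢ≡v = wᵢ≡v

nonempty : Block → Bool
nonempty B = not (null B)

levelSet : List ℕ → ℕ → Block
levelSet w v = occurrences suc v w

levelSets : List ℕ → SetComp
levelSets w = filterᵇ nonempty (map (levelSet w) (upTo (suc (maxL w))))

rho≡levelSets : ∀ w → rho w ≡ levelSets w
rho≡levelSets w = cong (filterᵇ nonempty) (map-cong (λ v → positions≡occurrences v w) _)

∈-levelSets⁻ : ∀ w {B} → B ∈ levelSets w → ∃[ v ] (B ≡ levelSet w v × B ≢ [])
∈-levelSets⁻ w B∈ with ∈-filter⁻ (T? ∘ nonempty) B∈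
... | B∈′ , ne with ∈-map⁻ (levelSet w) B∈′
...   | v , _ , refl = v , refl , λ B≡[] → subst (T ∘ nonempty) B≡[] ne

at≤maxL : ∀ w i → at w i ≤ maxL w
at≤maxL [] i = z≤n
at≤maxL (a ∷ w) zero = m≤m⊔n a (maxL w)
at≤maxL (a ∷ w) (suc i) = ≤-trans (at≤maxL w i) (m≤n⊔m a (maxL w))

levelSets-nonempty : ∀ w → All (_≢ []) (levelSets w)
levelSets-nonempty w = All.tabulate (proj₂ ∘ proj₂ ∘ ∈-levelSets⁻ w)

levelSets-sorted : ∀ w → All (Linked _<_) (levelSets w)
levelSets-sorted w = All.tabulate sorted
  where
  sorted : ∀ {B} → B ∈ levelSets w → Linked _<_ B
  sorted B∈ with ∈-levelSets⁻ w B∈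
  ... | v , refl , _ = occurrences-sorted suc v w s≤s

levelSets-⊆-range : ∀ w → concat (levelSets w) ⊆ range (length w)
levelSets-⊆-range w p∈ with ∈-concat⁻′ (levelSets w) p∈
... | B , p∈B , B∈ with ∈-levelSets⁻ w B∈
...   | v , refl , _ with ∈-occurrences⁻ suc v w p∈B
...     | i , i< , refl , _ = ∈-range⁺ i<

range-⊆-levelSets : ∀ w → range (length w) ⊆ concat (levelSets w)
range-⊆-levelSets w p∈ with ∈-range⁻ p∈
... | i , i< , refl = ∈-concat⁺′ i∈ (∈-filter⁺ (T? ∘ nonempty) (∈-map⁺ (levelSet w) v∈) (nonempty-∈ i∈))
  where
  i∈ = ∈-occurrences⁺ suc w i<
  v∈ : at w i ∈ upTo (suc (maxL w))
  v∈ = ∈-applyUpTo⁺ id (s≤s (at≤maxL w i))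
  nonempty-∈ : ∀ {p : ℕ} {B} → p ∈ B → T (nonempty B)
  nonempty-∈ (here _) = _
  nonempty-∈ (there _) = _

levelSets-chain : ∀ w m vs → Linked _<_ vs →
  (∀ {v} → v ∈ vs → levelSet w v ≢ [] → T (above (valueBelow (letter w)) m (levelSet w v))) →
  T (chain (valueBelow (letter w)) m (filterᵇ nonempty (map (levelSet w) vs)))
levelSets-chain w m [] _ _ = _
levelSets-chain w m (v ∷ vs) vs↗ bound with levelSet w v in eq
... | [] = levelSets-chain w m vs (Linked.tail vs↗) (bound ∘ there)
... | b ∷ bs = T-∧⁺ (subst (T ∘ above _ m) eq (bound (here refl) (λ e → b∷bs≢[] (trans (sym eq) e))))
                    (levelSets-chain w (just (b ∷ bs)) vs (Linked.tail vs↗) above-b)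
  where
  b∷bs≢[] : b ∷ bs ≢ []
  b∷bs≢[] ()
  above-b : ∀ {v′} → v′ ∈ vs → levelSet w v′ ≢ [] → T (letter w b <ᵇ value (letter w) (levelSet w v′))
  above-b {v′} v′∈ ne = <⇒<ᵇ (subst₂ _<_ (sym (letter-occurrences w v (subst (b ∈_) (sym eq) (here refl))))
                                          (sym (letter-occurrences w v′ (minB∈ ne)))
                                          (All.lookup (Linked-head vs↗) v′∈))

levelSets-graded : ∀ w → T (graded (letter w) (valueBelow (letter w)) (levelSets w))
levelSets-graded w = T-∧⁺ (all⁻ _ (All.tabulate constant))
                          (levelSets-chain w nothing (upTo (suc (maxL w))) (applyUpTo⁺₂ id _ n<1+n) (λ _ _ → _))
  where
  constant : ∀ {B} → B ∈ levelSets w → T (constantOn (letter w) B)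
  constant B∈ with ∈-levelSets⁻ w B∈
  ... | v , refl , _ = constantOn⁺ (letter w) (levelSet w v) v (letter-occurrences w v)

chain-valueBelow-< : ∀ f z X → T (all (constantOn f) X) → T (chain (valueBelow f) (just z) X) →
                     ∀ {p} → p ∈ concat X → value f z < f p
chain-valueBelow-< f z (B ∷ X) constant ascending p∈ with T-∧⁻ {constantOn f B} constant | T-∧⁻ {valueBelow f z B} ascending
... | cB , cX | z<B , chX with ∈-++⁻ B p∈
...   | inj₁ p∈B = subst (value f z <_) (sym (constantOn⁻ f B cB p∈B)) (<ᵇ⇒< _ _ z<B)
...   | inj₂ p∈X = <-trans (<ᵇ⇒< _ _ z<B) (chain-valueBelow-< f B X cX chX p∈X)

record GradedCons (f : ℕ → ℕ) (B : Block) (Y : SetComp) : Set where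
  field
    head-constant : T (constantOn f B)
    tail-graded : T (graded f (valueBelow f) Y)
    tail-above : ∀ {p} → p ∈ concat Y → value f B < f p

graded-cons : ∀ f B Y → T (graded f (valueBelow f) (B ∷ Y)) → GradedCons f B Y
graded-cons f B Y t with T-∧⁻ t
... | constant , ascending with T-∧⁻ {constantOn f B} constant
...   | cB , cY = record
  { head-constant = cB
  ; tail-graded = T-∧⁺ cY (chain-unbounded (valueBelow f) B Y ascending)
  ; tail-above = chain-valueBelow-< f B Y cY ascending
  }

module _ {f B Y} (G : GradedCons f B Y) where
  open GradedCons G

  head-value-≤ : ∀ {p} → p ∈ concat (B ∷ Y) → value f B ≤ f p
  head-value-≤ p∈ with ∈-++⁻ B p∈
  ... | inj₁ p∈B = ≤-reflexive (sym (constantOn⁻ f B head-constant p∈B))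
  ... | inj₂ p∈Y = <⇒≤ (tail-above p∈Y)

  split-⊆ : ∀ {A X} → GradedCons f A X → value f A ≡ value f B → concat (A ∷ X) ⊆ concat (B ∷ Y) →
            A ⊆ B × concat X ⊆ concat Y
  split-⊆ {A} {X} GA vA≡vB sub = A⊆B , X⊆Y
    where
    A⊆B : A ⊆ B
    A⊆B p∈ with ∈-++⁻ B (sub (∈-++⁺ˡ p∈))
    ... | inj₁ p∈B = p∈B
    ... | inj₂ p∈Y = ⊥-elim (<-irrefl (trans (sym vA≡vB) (sym (constantOn⁻ f A (GradedCons.head-constant GA) p∈)))
                                     (tail-above p∈Y))
    X⊆Y : concat X ⊆ concat Y
    X⊆Y p∈ with ∈-++⁻ B (sub (∈-++⁺ʳ A p∈))
    ... | inj₂ p∈Y = p∈Y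
    ... | inj₁ p∈B = ⊥-elim (<-irrefl (trans vA≡vB (sym (constantOn⁻ f B head-constant p∈B)))
                                     (GradedCons.tail-above GA p∈))

-- Both first blocks must consist of all positions carrying the smallest letter.
graded-unique : ∀ f {X Y} → All (_≢ []) X → All (Linked _<_) X → All (_≢ []) Y → All (Linked _<_) Y →
  concat X ⊆ concat Y → concat Y ⊆ concat X →
  T (graded f (valueBelow f) X) → T (graded f (valueBelow f) Y) → X ≡ Y
graded-unique f {[]} {[]} _ _ _ _ _ _ _ _ = refl
graded-unique f {[]} {B ∷ Y} _ _ (B≢[] ∷ _) _ _ sup _ _ with sup (∈-++⁺ˡ (minB∈ B≢[]))
... | ()
graded-unique f {A ∷ X} {[]} (A≢[] ∷ _) _ _ _ sub _ _ _ with sub (∈-++⁺ˡ (minB∈ A≢[]))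
... | ()
graded-unique f {A ∷ X} {B ∷ Y} (A≢[] ∷ neX) (A↗ ∷ sX) (B≢[] ∷ neY) (B↗ ∷ sY) sub sup gAX gBY =
  cong₂ _∷_ (sorted-unique A↗ B↗ (proj₁ AX⊆BY) (proj₁ BY⊆AX))
            (graded-unique f neX sX neY sY (proj₂ AX⊆BY) (proj₂ BY⊆AX) (GradedCons.tail-graded GA) (GradedCons.tail-graded GB))
  where
  GA = graded-cons f A X gAX
  GB = graded-cons f B Y gBY
  vA≡vB : value f A ≡ value f B
  vA≡vB = ≤-antisym (head-value-≤ GA (sup (∈-++⁺ˡ (minB∈ B≢[])))) (head-value-≤ GB (sub (∈-++⁺ˡ (minB∈ A≢[]))))
  AX⊆BY = split-⊆ GB GA vA≡vB sub
  BY⊆AX = split-⊆ GA GB (sym vA≡vB) sup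

==⇒≡ : ∀ {Φ Ψ} → T (Φ == Ψ) → Φ ≡ Ψ
==⇒≡ {Φ} {Ψ} t with ≡-dec (≡-dec _≟_) Φ Ψ
... | yes Φ≡Ψ = Φ≡Ψ

≡⇒== : ∀ {Φ Ψ} → Φ ≡ Ψ → T (Φ == Ψ)
≡⇒== {Φ} {Ψ} Φ≡Ψ with ≡-dec (≡-dec _≟_) Φ Ψ
... | yes _ = _
... | no Φ≢Ψ = Φ≢Ψ Φ≡Ψ

M-spec : ∀ {n X} w → IsSetComp n X →
         M X w ≡ 𝟙 ((length w ≡ᵇ n) ∧ graded (letter w) (valueBelow (letter w)) X)
M-spec {n} {X} w X∈SC = cong 𝟙 (bool-ext to from)
  where
  to : T (rho w == X) → T ((length w ≡ᵇ n) ∧ graded (letter w) (valueBelow (letter w)) X)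
  to t with trans (sym (rho≡levelSets w)) (==⇒≡ t)
  ... | refl = T-∧⁺ (≡⇒≡ᵇ _ _ (≤-antisym (range-⊆⇒≤ (setComp-⊆-range X∈SC ∘ range-⊆-levelSets w))
                                          (range-⊆⇒≤ (levelSets-⊆-range w ∘ range-⊆-setComp X∈SC))))
                    (levelSets-graded w)
  from : T ((length w ≡ᵇ n) ∧ graded (letter w) (valueBelow (letter w)) X) → T (rho w == X)
  from t with T-∧⁻ t
  ... | |w|≡ᵇn , gX = ≡⇒== (trans (rho≡levelSets w)
    (graded-unique (letter w) (levelSets-nonempty w) (levelSets-sorted w) (proj₁ X∈SC) (proj₁ (proj₂ X∈SC))
                   (range-⊆-setComp X∈SC ∘ subst (_ ∈_) [w]≡[n] ∘ levelSets-⊆-range w)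
                   (range-⊆-levelSets w ∘ subst (_ ∈_) (sym [w]≡[n]) ∘ setComp-⊆-range X∈SC)
                   (levelSets-graded w) gX))
    where
    [w]≡[n] : range (length w) ≡ range n
    [w]≡[n] = cong range (≡ᵇ⇒≡ _ _ |w|≡ᵇn)


-- LDD fillings and the coefficients of P

concat-joinFirst : ∀ B F → concat (joinFirst B F) ≡ B ∷ concat F
concat-joinFirst B [] = refl
concat-joinFirst B (c ∷ F) = refl

joinFirst-nonempty : ∀ B F → All (_≢ []) F → All (_≢ []) (joinFirst B F)
joinFirst-nonempty B [] _ = (λ ()) ∷ []
joinFirst-nonempty B (c ∷ F) (_ ∷ ne) = (λ ()) ∷ ne

FillingOf : SetComp → Filling → Set
FillingOf Φ F = concat F ≡ Φ × All (_≢ []) F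

∈-LDD-step⁻ : ∀ B B′ rest → (∀ {F} → F ∈ LDD (B′ ∷ rest) → FillingOf (B′ ∷ rest) F) →
              ∀ {F} → F ∈ LDD (B ∷ B′ ∷ rest) → FillingOf (B ∷ B′ ∷ rest) F
∈-LDD-step⁻ B B′ rest ih F∈ with ∈-++⁻ (map ((B ∷ []) ∷_) (LDD (B′ ∷ rest))) F∈
... | inj₁ F∈sep with ∈-map⁻ ((B ∷ []) ∷_) F∈sep
...   | F′ , F′∈ , refl with ih F′∈
...     | concat≡ , ne = cong (B ∷_) concat≡ , (λ ()) ∷ ne
∈-LDD-step⁻ B B′ rest ih F∈ | inj₂ F∈join with ∈-map⁻ (joinFirst B) (∈-if⁻ (B >D B′) F∈join)
...   | F′ , F′∈ , refl with ih F′∈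
...     | concat≡ , ne = trans (concat-joinFirst B F′) (cong (B ∷_) concat≡) , joinFirst-nonempty B F′ ne

∈-LDD⁻ : ∀ Φ {F} → F ∈ LDD Φ → FillingOf Φ F
∈-LDD⁻ [] (here refl) = refl , []
∈-LDD⁻ (B ∷ []) (here refl) = refl , (λ ()) ∷ []
∈-LDD⁻ (B ∷ B′ ∷ rest) = ∈-LDD-step⁻ B B′ rest (∈-LDD⁻ (B′ ∷ rest))

∈-LDD-∷ : ∀ B rest {F} → F ∈ LDD (B ∷ rest) → ∃[ c ] ∃[ F′ ] F ≡ (B ∷ c) ∷ F′
∈-LDD-∷ B rest {F} F∈ with F | ∈-LDD⁻ (B ∷ rest) F∈
... | [] ∷ F′ | _ , c≢[] ∷ _ = ⊥-elim (c≢[] refl)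
... | (B″ ∷ c) ∷ F′ | concat≡ , _ with ∷-injectiveˡ concat≡
...   | refl = c , F′ , refl

∑-LDD-∷-∷ : ∀ B B′ rest (g : Filling → ℕ) →
  ∑ (LDD (B ∷ B′ ∷ rest)) g ≡ ∑[ F ← LDD (B′ ∷ rest) ] g ((B ∷ []) ∷ F) + 𝟙 (B >D B′) * ∑[ F ← LDD (B′ ∷ rest) ] g (joinFirst B F)
∑-LDD-∷-∷ B B′ rest g = begin
  ∑ (map ((B ∷ []) ∷_) L ++ (if B >D B′ then map (joinFirst B) L else [])) g
    ≡⟨ ∑-++ (map ((B ∷ []) ∷_) L) _ g ⟩
  ∑ (map ((B ∷ []) ∷_) L) g + ∑ (if B >D B′ then map (joinFirst B) L else []) g
    ≡⟨ cong₂ _+_ (∑-map ((B ∷ []) ∷_) L g)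
                 (trans (∑-if (B >D B′) (map (joinFirst B) L) g) (cong (𝟙 (B >D B′) *_) (∑-map (joinFirst B) L g))) ⟩
  ∑[ F ← L ] g ((B ∷ []) ∷ F) + 𝟙 (B >D B′) * ∑[ F ← L ] g (joinFirst B F) ∎
  where
  open ≡-Reasoning
  L = LDD (B′ ∷ rest)

col-↭ : ∀ F → concat (col F) ↭ concat (concat F)
col-↭ [] = ↭-refl
col-↭ (c ∷ F) = ↭-trans (↭-++⁺ (sortℕ-↭ (concat c)) (col-↭ F)) (↭-reflexive (concat-++ c (concat F)))

col-setComp : ∀ {n Φ F} → IsSetComp n Φ → F ∈ LDD Φ → IsSetComp n (col F)
col-setComp {n} {Φ} {F} (Φ-nonempty , _ , Φ↭[n]) F∈ =
  All-map⁺ (All.tabulate column-nonempty) ,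
  All-map⁺ (All.tabulate (λ c∈ → sortℕ-sorted (Unique-concat⁻ unique (∈-map⁺ concat c∈)))) ,
  ↭-trans (col-↭ F) (subst (λ X → concat X ↭ range n) (sym concat≡) Φ↭[n])
  where
  concat≡ = proj₁ (∈-LDD⁻ Φ F∈)
  unique : Unique (concat (map concat F))
  unique = subst Unique (sym (trans (concat-concat F) (cong concat concat≡)))
                 (Unique-resp-↭ (↭-sym Φ↭[n]) (Linked⇒Unique (range-sorted n)))
  column-nonempty : ∀ {c} → c ∈ F → sortℕ (concat c) ≢ []
  column-nonempty {[]} c∈ _ = All.lookup (proj₂ (∈-LDD⁻ Φ F∈)) c∈ refl
  column-nonempty {B ∷ c} c∈ sorted≡[] with ↭-empty-inv (↭-trans (↭-sym (sortℕ-↭ (B ++ concat c))) (↭-reflexive sorted≡[]))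
  ... | B++≡[] = All.lookup Φ-nonempty (subst (B ∈_) concat≡ (∈-concat⁺′ (here refl) c∈)) (++-conicalˡ B _ B++≡[])

separate-graded : ∀ f B B′ C R → B ≢ [] → B′ ≢ [] →
  graded f (valueBelow f) (sortℕ (B ++ []) ∷ sortℕ (B′ ++ C) ∷ R)
  ≡ (constantOn f B ∧ valueBelow f B B′) ∧ graded f (valueBelow f) (sortℕ (B′ ++ C) ∷ R)
separate-graded f B B′ C R B≢[] B′≢[] = begin
  graded f vb (sB ∷ s₀ ∷ R)           ≡⟨ graded-∷-∷ f vb sB s₀ R ⟩
  constantOn f sB ∧ (vb sB s₀ ∧ G)    ≡⟨ cong (λ c → c ∧ (vb sB s₀ ∧ G)) sB-constant ⟩
  constantOn f B ∧ (vb sB s₀ ∧ G)     ≡⟨ ∧-cong-between (constantOn f B) _ _ G values ⟩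
  constantOn f B ∧ (vb B B′ ∧ G)      ≡⟨ sym (∧-assoc (constantOn f B) _ _) ⟩
  (constantOn f B ∧ vb B B′) ∧ G      ∎
  where
  open ≡-Reasoning
  vb = valueBelow f
  sB = sortℕ (B ++ [])
  s₀ = sortℕ (B′ ++ C)
  G = graded f vb (s₀ ∷ R)
  sB-constant : constantOn f sB ≡ constantOn f B
  sB-constant = trans (constantOn-sortℕ f (B ++ [])) (cong (constantOn f) (++-identityʳ B))
  values : T (constantOn f B) → T G → vb sB s₀ ≡ vb B B′
  values tB tG = cong₂ _<ᵇ_ (value-sortℕ-++ f [] B≢[] (subst T (sym sB-constant) tB))
                           (value-sortℕ-++ f C B′≢[] (proj₁ (T-∧⁻ (proj₁ (T-∧⁻ tG)))))

join-graded : ∀ f B B′ C R → B ≢ [] → B′ ≢ [] →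
  graded f (valueBelow f) (sortℕ (B ++ (B′ ++ C)) ∷ R)
  ≡ (constantOn f B ∧ (value f B ≡ᵇ value f B′)) ∧ graded f (valueBelow f) (sortℕ (B′ ++ C) ∷ R)
join-graded f B B′ C R B≢[] B′≢[] = begin
  graded f vb (J ∷ R)                               ≡⟨ graded-∷ f vb J R ⟩
  constantOn f J ∧ (aR ∧ chain vb (just J) R)       ≡⟨ cong (_∧ (aR ∧ chain vb (just J) R)) J-constant ⟩
  ((cB ∧ cs₀) ∧ e) ∧ (aR ∧ chain vb (just J) R)    ≡⟨ ∧-cong-when ((cB ∧ cs₀) ∧ e) (cong (aR ∧_) ∘ chain-valueBelow-head f R ∘ vJ≡vs₀) ⟩
  ((cB ∧ cs₀) ∧ e) ∧ (aR ∧ chain vb (just s₀) R)   ≡⟨ ∧-regroup cB cs₀ e _ ⟩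
  (cB ∧ e) ∧ (cs₀ ∧ (aR ∧ chain vb (just s₀) R))   ≡⟨ cong ((cB ∧ e) ∧_) (sym (graded-∷ f vb s₀ R)) ⟩
  (cB ∧ e) ∧ graded f vb (s₀ ∷ R)                   ∎
  where
  open ≡-Reasoning
  vb = valueBelow f
  J = sortℕ (B ++ (B′ ++ C))
  s₀ = sortℕ (B′ ++ C)
  aR = all (constantOn f) R
  cB = constantOn f B
  cs₀ = constantOn f s₀
  e = value f B ≡ᵇ value f B′
  J-constant : constantOn f J ≡ (cB ∧ cs₀) ∧ e
  J-constant = begin
    constantOn f J                                                                ≡⟨ constantOn-sortℕ f (B ++ (B′ ++ C)) ⟩
    constantOn f (B ++ (B′ ++ C))                                                 ≡⟨ constantOn-++ f B≢[] (B′≢[] ∘ ++-conicalˡ B′ C) ⟩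
    (cB ∧ constantOn f (B′ ++ C)) ∧ (value f B ≡ᵇ value f (B′ ++ C))             ≡⟨ cong₂ (λ c v → (cB ∧ c) ∧ (value f B ≡ᵇ v))
                                                                                       (sym (constantOn-sortℕ f (B′ ++ C))) (value-++ f C B′≢[]) ⟩
    (cB ∧ cs₀) ∧ e                                                                ∎
  vJ≡vs₀ : T ((cB ∧ cs₀) ∧ e) → value f J ≡ value f s₀
  vJ≡vs₀ t with T-∧⁻ t
  ... | cBs₀ , vB≡vB′ = begin
    value f J   ≡⟨ value-sortℕ-++ f (B′ ++ C) B≢[] (subst T (sym J-constant) t) ⟩
    value f B   ≡⟨ ≡ᵇ⇒≡ _ _ vB≡vB′ ⟩
    value f B′  ≡⟨ sym (value-sortℕ-++ f C B′≢[] (proj₂ (T-∧⁻ {cB} cBs₀))) ⟩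
    value f s₀  ∎

𝟙-split : ∀ c lt eq d → (T lt → T eq → ⊥) → 𝟙 (c ∧ lt) + 𝟙 d * 𝟙 (c ∧ eq) ≡ 𝟙 (c ∧ (lt ∨ (eq ∧ d)))
𝟙-split false lt eq d _ = *-zeroʳ (𝟙 d)
𝟙-split true true true d exclusive = ⊥-elim (exclusive _ _)
𝟙-split true true false d _ = cong suc (*-zeroʳ (𝟙 d))
𝟙-split true false eq d _ = trans (*-comm (𝟙 d) (𝟙 eq)) (sym (𝟙-∧ eq d))

∑-LDD-graded : ∀ f Φ → All (_≢ []) Φ →
  ∑[ F ← LDD Φ ] 𝟙 (graded f (valueBelow f) (col F)) ≡ 𝟙 (admissible f Φ)
∑-LDD-graded f [] _ = refl
∑-LDD-graded f (B ∷ []) _ = trans (+-identityʳ _)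
  (cong (λ c → 𝟙 ((c ∧ true) ∧ true)) (trans (constantOn-sortℕ f (B ++ [])) (cong (constantOn f) (++-identityʳ B))))
∑-LDD-graded f (B ∷ B′ ∷ rest) (B≢[] ∷ ne@(B′≢[] ∷ _)) = begin
  ∑ (LDD (B ∷ B′ ∷ rest)) g
    ≡⟨ ∑-LDD-∷-∷ B B′ rest g ⟩
  ∑[ F ← L ] g ((B ∷ []) ∷ F) + 𝟙 d * ∑[ F ← L ] g (joinFirst B F)
    ≡⟨ cong₂ (λ x y → x + 𝟙 d * y) (∑-cong L separate-term) (∑-cong L join-term) ⟩
  ∑[ F ← L ] (𝟙 (cB ∧ lt) * g F) + 𝟙 d * ∑[ F ← L ] (𝟙 (cB ∧ eq) * g F)
    ≡⟨ ∑-scale-+ (𝟙 (cB ∧ lt)) (𝟙 d) (𝟙 (cB ∧ eq)) L g ⟩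
  (𝟙 (cB ∧ lt) + 𝟙 d * 𝟙 (cB ∧ eq)) * S
    ≡⟨ cong₂ _*_ (𝟙-split cB lt eq d exclusive) (∑-LDD-graded f (B′ ∷ rest) ne) ⟩
  𝟙 (cB ∧ precedes f B B′) * 𝟙 (admissible f (B′ ∷ rest))
    ≡⟨ sym (𝟙-∧ (cB ∧ precedes f B B′) (admissible f (B′ ∷ rest))) ⟩
  𝟙 ((cB ∧ precedes f B B′) ∧ admissible f (B′ ∷ rest))
    ≡⟨ cong 𝟙 (trans (∧-assoc cB (precedes f B B′) (admissible f (B′ ∷ rest))) (sym (graded-∷-∷ f (precedes f) B B′ rest))) ⟩
  𝟙 (admissible f (B ∷ B′ ∷ rest))  ∎
  where
  open ≡-Reasoning
  L = LDD (B′ ∷ rest)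
  d = B >D B′
  cB = constantOn f B
  lt = valueBelow f B B′
  eq = value f B ≡ᵇ value f B′
  g : Filling → ℕ
  g F = 𝟙 (graded f (valueBelow f) (col F))
  S = ∑ L g
  exclusive : T lt → T eq → ⊥
  exclusive B<B′ B≡B′ = <-irrefl (≡ᵇ⇒≡ (value f B) (value f B′) B≡B′) (<ᵇ⇒< (value f B) (value f B′) B<B′)
  separate-term : ∀ F → F ∈ L → g ((B ∷ []) ∷ F) ≡ 𝟙 (cB ∧ lt) * g F
  separate-term F F∈ with ∈-LDD-∷ B′ rest F∈
  ... | c , F′ , refl = trans (cong 𝟙 (separate-graded f B B′ (concat c) (col F′) B≢[] B′≢[])) (𝟙-∧ (cB ∧ lt) _)
  join-term : ∀ F → F ∈ L → g (joinFirst B F) ≡ 𝟙 (cB ∧ eq) * g F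
  join-term F F∈ with ∈-LDD-∷ B′ rest F∈
  ... | c , F′ , refl = trans (cong 𝟙 (join-graded f B B′ (concat c) (col F′) B≢[] B′≢[])) (𝟙-∧ (cB ∧ eq) _)

P-spec : ∀ {n Φ} w → IsSetComp n Φ → P Φ w ≡ 𝟙 ((length w ≡ᵇ n) ∧ admissible (letter w) Φ)
P-spec {n} {Φ} w Φ∈SC = begin
  ∑[ F ← LDD Φ ] M (col F) w
    ≡⟨ ∑-cong (LDD Φ) (λ F F∈ → trans (M-spec w (col-setComp Φ∈SC F∈)) (𝟙-∧ (length w ≡ᵇ n) _)) ⟩
  ∑[ F ← LDD Φ ] (𝟙 (length w ≡ᵇ n) * 𝟙 (graded f (valueBelow f) (col F)))
    ≡⟨ ∑-*ˡ (𝟙 (length w ≡ᵇ n)) (LDD Φ) _ ⟩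
  𝟙 (length w ≡ᵇ n) * ∑[ F ← LDD Φ ] 𝟙 (graded f (valueBelow f) (col F))
    ≡⟨ cong (𝟙 (length w ≡ᵇ n) *_) (∑-LDD-graded f Φ (proj₁ Φ∈SC)) ⟩
  𝟙 (length w ≡ᵇ n) * 𝟙 (admissible f Φ)
    ≡⟨ sym (𝟙-∧ (length w ≡ᵇ n) _) ⟩
  𝟙 ((length w ≡ᵇ n) ∧ admissible f Φ) ∎
  where
  open ≡-Reasoning
  f = letter w


-- The product

at-take : ∀ n w {i} → i < n → at (take n w) i ≡ at w i
at-take (suc n) [] _ = refl
at-take (suc n) (a ∷ w) {zero} _ = refl
at-take (suc n) (a ∷ w) {suc i} (s≤s i<n) = at-take n w i<n

at-drop : ∀ n w i → at (drop n w) i ≡ at w (n + i)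
at-drop zero w i = refl
at-drop (suc n) [] i = refl
at-drop (suc n) (a ∷ w) i = at-drop n w i

admissible-take : ∀ {n X} w → IsSetComp n X →
  admissible (letter (take n w)) X ≡ admissible (letter w) X
admissible-take {n} {X} w X∈SC = admissible-cong X (proj₁ X∈SC) agree
  where
  agree : ∀ {p} → p ∈ concat X → letter (take n w) p ≡ letter w p
  agree p∈ with ∈-range⁻ (setComp-⊆-range X∈SC p∈)
  ... | i , i<n , refl = at-take n w i<n

admissible-drop : ∀ {m X} n w → IsSetComp m X → admissible (letter (drop n w)) X ≡ admissible (letter w ∘ (n +_)) X
admissible-drop {m} {X} n w X∈SC = admissible-cong X (proj₁ X∈SC) agree
  where
  agree : ∀ {p} → p ∈ concat X → letter (drop n w) p ≡ letter w (n + p)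
  agree p∈ with ∈-range⁻ (setComp-⊆-range X∈SC p∈)
  ... | i , _ , refl = trans (at-drop n w i) (cong (letter w) (sym (+-suc n i)))

length-take-≤ : ∀ {i} (w : List ℕ) → i ≤ length w → length (take i w) ≡ i
length-take-≤ {i} w i≤ = trans (length-take i w) (m≤n⇒m⊓n≡m i≤)

∑-shuffle-P : ∀ {n m Φ Ψ} → IsSetComp n Φ → IsSetComp m Ψ → ∀ w →
  ∑[ Γ ← shuffle Φ (Ψ ↑ n) ] P Γ w ≡ 𝟙 (length w ≡ᵇ n + m) * (𝟙 (admissible (letter w) Φ) * 𝟙 (admissible (letter w ∘ (n +_)) Ψ))
∑-shuffle-P {n} {m} {Φ} {Ψ} Φ∈SC Ψ∈SC w = begin
  ∑[ Γ ← S ] P Γ w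
    ≡⟨ ∑-cong S (λ Γ Γ∈ → trans (P-spec w (shuffle-setComp Φ∈SC Ψ∈SC Γ∈)) (𝟙-∧ (L ≡ᵇ n + m) _)) ⟩
  ∑[ Γ ← S ] (𝟙 (L ≡ᵇ n + m) * 𝟙 (admissible f Γ))
    ≡⟨ ∑-*ˡ (𝟙 (L ≡ᵇ n + m)) S _ ⟩
  𝟙 (L ≡ᵇ n + m) * ∑[ Γ ← S ] 𝟙 (admissible f Γ)
    ≡⟨ cong (𝟙 (L ≡ᵇ n + m) *_) (∑-shuffle-admissible f Φ (Ψ ↑ n) (shuffle-distinct Φ∈SC Ψ∈SC)) ⟩
  𝟙 (L ≡ᵇ n + m) * (𝟙 (admissible f Φ) * 𝟙 (admissible f (Ψ ↑ n)))
    ≡⟨ cong (λ g → 𝟙 (L ≡ᵇ n + m) * (𝟙 (admissible f Φ) * 𝟙 g)) (admissible-↑ f n Ψ (proj₁ Ψ∈SC)) ⟩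
  𝟙 (L ≡ᵇ n + m) * (𝟙 (admissible f Φ) * 𝟙 (admissible (f ∘ (n +_)) Ψ)) ∎
  where
  open ≡-Reasoning
  L = length w
  f = letter w
  S = shuffle Φ (Ψ ↑ n)

P-cut-off : ∀ {n m Φ Ψ} → IsSetComp n Φ → IsSetComp m Ψ → ∀ w {i} → i ≤ length w → i ≢ n →
            P Φ (take i w) * P Ψ (drop i w) ≡ 0
P-cut-off {n} {m} {Φ} {Ψ} Φ∈SC Ψ∈SC w {i} i≤L i≢n = trans (cong₂ _*_ (P-spec (take i w) Φ∈SC) (P-spec (drop i w) Ψ∈SC))
  (cong (λ b → 𝟙 (b ∧ admissible (letter (take i w)) Φ) * 𝟙 ((length (drop i w) ≡ᵇ m) ∧ admissible (letter (drop i w)) Ψ))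
        (trans (cong (_≡ᵇ n) (length-take-≤ w i≤L)) (≢⇒≡ᵇ-false i≢n)))

P-cut-at : ∀ {n m Φ Ψ} → IsSetComp n Φ → IsSetComp m Ψ → ∀ w → n ≤ length w →
  P Φ (take n w) * P Ψ (drop n w) ≡ 𝟙 (admissible (letter w) Φ) * 𝟙 ((length w ∸ n ≡ᵇ m) ∧ admissible (letter w ∘ (n +_)) Ψ)
P-cut-at {n} {m} {Φ} {Ψ} Φ∈SC Ψ∈SC w n≤L = trans (cong₂ _*_ (P-spec (take n w) Φ∈SC) (P-spec (drop n w) Ψ∈SC))
  (cong₂ (λ a b → 𝟙 a * 𝟙 b)
    (trans (cong (λ k → (k ≡ᵇ n) ∧ admissible (letter (take n w)) Φ) (length-take-≤ w n≤L))
           (trans (cong (_∧ admissible (letter (take n w)) Φ) (≡⇒≡ᵇ-true {n} refl)) (admissible-take w Φ∈SC)))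
    (cong₂ (λ k g → (k ≡ᵇ m) ∧ g) (length-drop n w) (admissible-drop n w Ψ∈SC)))

product-formula : ∀ {n m Φ Ψ} → IsSetComp n Φ → IsSetComp m Ψ → ∀ w →
                  (P Φ ⋆ P Ψ) w ≡ ∑[ Γ ← shuffle Φ (Ψ ↑ n) ] P Γ w
product-formula {n} {m} {Φ} {Ψ} Φ∈SC Ψ∈SC w = trans concatenations (sym (∑-shuffle-P Φ∈SC Ψ∈SC w))
  where
  open ≡-Reasoning
  L = length w
  GΦ = admissible (letter w) Φ
  GΨ = admissible (letter w ∘ (n +_)) Ψ
  term : ℕ → ℕ
  term i = P Φ (take i w) * P Ψ (drop i w)
  concatenations : ∑ (upTo (suc L)) term ≡ 𝟙 (L ≡ᵇ n + m) * (𝟙 GΦ * 𝟙 GΨ)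
  concatenations with L ≟ n + m
  ... | yes L≡n+m = begin
    ∑ (upTo (suc L)) term              ≡⟨ ∑-upTo-single (suc L) term n (s≤s n≤L) (λ i i≤L → P-cut-off Φ∈SC Ψ∈SC w (≤-pred i≤L)) ⟩
    term n                             ≡⟨ P-cut-at Φ∈SC Ψ∈SC w n≤L ⟩
    𝟙 GΦ * 𝟙 ((L ∸ n ≡ᵇ m) ∧ GΨ)       ≡⟨ cong (λ b → 𝟙 GΦ * 𝟙 (b ∧ GΨ)) (≡⇒≡ᵇ-true (trans (cong (_∸ n) L≡n+m) (m+n∸m≡n n m))) ⟩
    𝟙 GΦ * 𝟙 GΨ                        ≡⟨ sym (*-identityˡ _) ⟩
    1 * (𝟙 GΦ * 𝟙 GΨ)                  ≡⟨ cong (λ b → 𝟙 b * (𝟙 GΦ * 𝟙 GΨ)) (sym (≡⇒≡ᵇ-true L≡n+m)) ⟩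
    𝟙 (L ≡ᵇ n + m) * (𝟙 GΦ * 𝟙 GΨ)     ∎
    where
    n≤L : n ≤ L
    n≤L = subst (n ≤_) (sym L≡n+m) (m≤m+n n m)
  ... | no L≢n+m = trans (∑-upTo-zero (suc L) term term-zero)
                         (cong (λ b → 𝟙 b * (𝟙 GΦ * 𝟙 GΨ)) (sym (≢⇒≡ᵇ-false L≢n+m)))
    where
    term-zero : ∀ i → i < suc L → term i ≡ 0
    term-zero i i≤L with i ≟ n
    ... | no i≢n = P-cut-off Φ∈SC Ψ∈SC w (≤-pred i≤L) i≢n
    ... | yes refl = begin
      term n                           ≡⟨ P-cut-at Φ∈SC Ψ∈SC w (≤-pred i≤L) ⟩
      𝟙 GΦ * 𝟙 ((L ∸ n ≡ᵇ m) ∧ GΨ)     ≡⟨ cong (λ b → 𝟙 GΦ * 𝟙 (b ∧ GΨ)) (≢⇒≡ᵇ-false (L≢n+m ∘ L∸n≡m⇒L≡n+m)) ⟩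
      𝟙 GΦ * 0                         ≡⟨ *-zeroʳ (𝟙 GΦ) ⟩
      0                                ∎
      where
      L∸n≡m⇒L≡n+m : L ∸ n ≡ m → L ≡ n + m
      L∸n≡m⇒L≡n+m L∸n≡m = trans (sym (m+[n∸m]≡n (≤-pred i≤L))) (cong (n +_) L∸n≡m)


-- Splitting LDD fillings into two

Kernel : Set
Kernel = Filling → Filling → ℕ

cutSum : Kernel → Filling → ℕ
cutSum k F = ∑[ j ← upTo (suc (length F)) ] k (take j F) (drop j F)

splitSum : Kernel → SetComp → ℕ → ℕ
splitSum k Φ i = ∑[ G ← LDD (take i Φ) ] ∑[ H ← LDD (drop i Φ) ] k G H

afterSeparate : Block → Kernel → Kernel
afterSeparate B k G H = k ((B ∷ []) ∷ G) H

afterJoin : Block → Kernel → Kernel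
afterJoin B k [] H = 0
afterJoin B k (c ∷ G) H = k ((B ∷ c) ∷ G) H

after : Block → Bool → Kernel → Kernel
after B d k G H = afterSeparate B k G H + 𝟙 d * afterJoin B k G H

∑-after : ∀ {A : Set} B d k (xs : List A) (G H : A → Filling) →
  ∑[ x ← xs ] after B d k (G x) (H x) ≡ ∑[ x ← xs ] afterSeparate B k (G x) (H x) + 𝟙 d * ∑[ x ← xs ] afterJoin B k (G x) (H x)
∑-after B d k xs G H = ∑-linear (𝟙 d) xs _ _

cutSum-after : ∀ B d k F → cutSum (after B d k) F ≡ cutSum (afterSeparate B k) F + 𝟙 d * cutSum (afterJoin B k) F
cutSum-after B d k F = ∑-after B d k (upTo (suc (length F))) (λ j → take j F) (λ j → drop j F)

splitSum-after : ∀ B d k Φ i → splitSum (after B d k) Φ i ≡ splitSum (afterSeparate B k) Φ i + 𝟙 d * splitSum (afterJoin B k) Φ i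
splitSum-after B d k Φ i = trans (∑-cong (LDD (take i Φ)) (λ G _ → ∑-after B d k (LDD (drop i Φ)) (λ _ → G) id))
                                 (∑-linear (𝟙 d) (LDD (take i Φ)) _ _)

cutSum-separate : ∀ B k F → cutSum k ((B ∷ []) ∷ F) ≡ k [] ((B ∷ []) ∷ F) + cutSum (afterSeparate B k) F
cutSum-separate B k F = ∑-upTo-suc (suc (length F)) (λ j → k (take j ((B ∷ []) ∷ F)) (drop j ((B ∷ []) ∷ F)))

cutSum-join : ∀ B k c F → cutSum k ((B ∷ c) ∷ F) ≡ k [] ((B ∷ c) ∷ F) + cutSum (afterJoin B k) (c ∷ F)
cutSum-join B k c F = trans (∑-upTo-suc (suc (length F)) (λ j → k (take j ((B ∷ c) ∷ F)) (drop j ((B ∷ c) ∷ F))))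
  (cong (k [] ((B ∷ c) ∷ F) +_) (sym (∑-upTo-suc (suc (length F)) (λ j → afterJoin B k (take j (c ∷ F)) (drop j (c ∷ F))))))

splitSum-step : ∀ B B′ rest k i → splitSum k (B ∷ B′ ∷ rest) (suc i) ≡ splitSum (after B (B >D B′) k) (B′ ∷ rest) i
splitSum-step B B′ rest k zero = cong (_+ 0) (∑-cong (LDD (B′ ∷ rest))
  (λ H _ → sym (trans (cong (k ((B ∷ []) ∷ []) H +_) (*-zeroʳ (𝟙 (B >D B′)))) (+-identityʳ _))))
splitSum-step B B′ rest k (suc i) = begin
  ∑ (LDD (B ∷ B′ ∷ take i rest)) inner
    ≡⟨ ∑-LDD-∷-∷ B B′ (take i rest) inner ⟩
  ∑[ G ← L ] inner ((B ∷ []) ∷ G) + 𝟙 d * ∑[ G ← L ] inner (joinFirst B G)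
    ≡⟨ cong (λ x → ∑[ G ← L ] inner ((B ∷ []) ∷ G) + 𝟙 d * x)
            (∑-cong L (λ G G∈ → join-inner (∈-LDD-∷ B′ (take i rest) G∈))) ⟩
  splitSum (afterSeparate B k) (B′ ∷ rest) (suc i) + 𝟙 d * splitSum (afterJoin B k) (B′ ∷ rest) (suc i)
    ≡⟨ sym (splitSum-after B d k (B′ ∷ rest) (suc i)) ⟩
  splitSum (after B d k) (B′ ∷ rest) (suc i) ∎
  where
  open ≡-Reasoning
  d = B >D B′
  L = LDD (B′ ∷ take i rest)
  inner : Filling → ℕ
  inner G = ∑[ H ← LDD (drop i rest) ] k G H
  join-inner : ∀ {G} → ∃[ c ] ∃[ G′ ] G ≡ (B′ ∷ c) ∷ G′ → inner (joinFirst B G) ≡ ∑[ H ← LDD (drop i rest) ] afterJoin B k G H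
  join-inner (c , G′ , refl) = refl

-- The first block B is pushed into the kernel, which separates it from or joins it to the first column.
LDD-splitting : ∀ Φ k → ∑[ F ← LDD Φ ] cutSum k F ≡ ∑[ i ← upTo (suc (length Φ)) ] splitSum k Φ i
LDD-splitting [] k = sym (+-identityʳ _)
LDD-splitting (B ∷ []) k = trans (+-identityʳ (a + (b + 0)))
  (cong₂ _+_ (sym (trans (+-identityʳ (a + 0)) (+-identityʳ a))) (sym (trans (+-identityʳ (b + 0 + 0)) (+-identityʳ (b + 0)))))
  where
  a = k [] ((B ∷ []) ∷ [])
  b = k ((B ∷ []) ∷ []) []
LDD-splitting (B ∷ B′ ∷ rest) k = begin
  ∑ (LDD Φ) (cutSum k)
    ≡⟨ ∑-LDD-∷-∷ B B′ rest (cutSum k) ⟩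
  ∑[ F ← L ] cutSum k ((B ∷ []) ∷ F) + 𝟙 d * ∑[ F ← L ] cutSum k (joinFirst B F)
    ≡⟨ cong₂ (λ x y → x + 𝟙 d * y) (trans (∑-cong L (λ F _ → cutSum-separate B k F)) (∑-+ L _ _))
                                     (trans (∑-cong L join-cuts) (∑-+ L _ _)) ⟩
  (a₁ + ∑ L (cutSum k₁)) + 𝟙 d * (a₂ + ∑ L (cutSum k₂))
    ≡⟨ cong ((a₁ + ∑ L (cutSum k₁)) +_) (*-distribˡ-+ (𝟙 d) a₂ _) ⟩
  (a₁ + ∑ L (cutSum k₁)) + (𝟙 d * a₂ + 𝟙 d * ∑ L (cutSum k₂))
    ≡⟨ +-interchange a₁ _ _ _ ⟩
  (a₁ + 𝟙 d * a₂) + (∑ L (cutSum k₁) + 𝟙 d * ∑ L (cutSum k₂))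
    ≡⟨ cong₂ _+_ first-split (sym (trans (∑-cong L (λ F _ → cutSum-after B d k F)) (∑-linear (𝟙 d) L _ _))) ⟩
  splitSum k Φ 0 + ∑ L (cutSum (after B d k))
    ≡⟨ cong (splitSum k Φ 0 +_) (LDD-splitting (B′ ∷ rest) (after B d k)) ⟩
  splitSum k Φ 0 + ∑[ i ← upTo (suc (length (B′ ∷ rest))) ] splitSum (after B d k) (B′ ∷ rest) i
    ≡⟨ cong (splitSum k Φ 0 +_) (sym (∑-cong (upTo (suc (length (B′ ∷ rest)))) (λ i _ → splitSum-step B B′ rest k i))) ⟩
  splitSum k Φ 0 + ∑[ i ← upTo (suc (length (B′ ∷ rest))) ] splitSum k Φ (suc i)
    ≡⟨ sym (∑-upTo-suc (suc (length (B′ ∷ rest))) (splitSum k Φ)) ⟩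
  ∑[ i ← upTo (suc (length Φ)) ] splitSum k Φ i ∎
  where
  open ≡-Reasoning
  Φ = B ∷ B′ ∷ rest
  L = LDD (B′ ∷ rest)
  d = B >D B′
  k₁ = afterSeparate B k
  k₂ = afterJoin B k
  a₁ = ∑[ F ← L ] k [] ((B ∷ []) ∷ F)
  a₂ = ∑[ F ← L ] k [] (joinFirst B F)
  join-cuts : ∀ F → F ∈ L → cutSum k (joinFirst B F) ≡ k [] (joinFirst B F) + cutSum k₂ F
  join-cuts F F∈ with ∈-LDD-∷ B′ rest F∈
  ... | c , F′ , refl = cutSum-join B k (B′ ∷ c) F′
  first-split : a₁ + 𝟙 d * a₂ ≡ splitSum k Φ 0
  first-split = trans (sym (∑-LDD-∷-∷ B B′ rest (k []))) (sym (+-identityʳ _))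


-- Standardization

rank : List ℕ → ℕ → ℕ
rank L x = ∑[ y ← L ] 𝟙 (y ≤ᵇ x)

st≡relabel : ∀ Y → st Y ≡ map (map (rank (concat Y))) Y
st≡relabel Y = map-cong (map-cong (length-filter (concat Y))) Y
  where
  length-filter : ∀ L x → length (filterᵇ (_≤ᵇ x) L) ≡ rank L x
  length-filter [] x = refl
  length-filter (y ∷ L) x with y ≤ᵇ x
  ... | true = cong suc (length-filter L x)
  ... | false = length-filter L x

rank-↭ : ∀ {L L′} x → L ↭ L′ → rank L x ≡ rank L′ x
rank-↭ x L↭L′ = sum-↭ (↭-map⁺ (λ y → 𝟙 (y ≤ᵇ x)) L↭L′)

𝟙-≤ᵇ-mono : ∀ z {x y} → x ≤ y → 𝟙 (z ≤ᵇ x) ≤ 𝟙 (z ≤ᵇ y)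
𝟙-≤ᵇ-mono z {x} {y} x≤y with z ≤ᵇ x in z≤ᵇx
... | false = z≤n
... | true rewrite Equivalence.to T-≡ (≤⇒≤ᵇ (≤-trans (≤ᵇ⇒≤ z x (subst T (sym z≤ᵇx) _)) x≤y)) = ≤-refl

rank-mono : ∀ L {x y} → x ≤ y → rank L x ≤ rank L y
rank-mono [] _ = z≤n
rank-mono (z ∷ L) x≤y = +-mono-≤ (𝟙-≤ᵇ-mono z x≤y) (rank-mono L x≤y)

rank-strict : ∀ L {x y} → y < x → x ∈ L → rank L y < rank L x
rank-strict (z ∷ L) {x} {y} y<x (here refl) rewrite ≰⇒≤ᵇ-false (<⇒≱ y<x) | Equivalence.to T-≡ (≤⇒≤ᵇ (≤-refl {x})) =
  s≤s (rank-mono L (<⇒≤ y<x))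
rank-strict (z ∷ L) y<x (there x∈) = +-mono-≤-< (𝟙-≤ᵇ-mono z (<⇒≤ y<x)) (rank-strict L y<x x∈)

rank-<ᵇ : ∀ L a {b} → b ∈ L → (rank L a <ᵇ rank L b) ≡ (a <ᵇ b)
rank-<ᵇ L a {b} b∈ = bool-ext to (λ a<b → <⇒<ᵇ (rank-strict L (<ᵇ⇒< a b a<b) b∈))
  where
  to : T (rank L a <ᵇ rank L b) → T (a <ᵇ b)
  to r< with <-cmp a b
  ... | tri< a<b _ _ = <⇒<ᵇ a<b
  ... | tri≈ _ refl _ = ⊥-elim (<-irrefl refl (<ᵇ⇒< (rank L a) (rank L a) r<))
  ... | tri> _ _ b<a = ⊥-elim (<-irrefl refl (<-≤-trans (<ᵇ⇒< _ _ r<) (rank-mono L (<⇒≤ b<a))))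

rank-≤ᵇ : ∀ L {a} b → a ∈ L → (rank L a ≤ᵇ rank L b) ≡ (a ≤ᵇ b)
rank-≤ᵇ L {a} b a∈ = bool-ext to (λ a≤b → ≤⇒≤ᵇ (rank-mono L (≤ᵇ⇒≤ a b a≤b)))
  where
  to : T (rank L a ≤ᵇ rank L b) → T (a ≤ᵇ b)
  to r≤ with ≤-<-connex a b
  ... | inj₁ a≤b = ≤⇒≤ᵇ a≤b
  ... | inj₂ b<a = ⊥-elim (<-irrefl refl (<-≤-trans (rank-strict L b<a a∈) (≤ᵇ⇒≤ _ _ r≤)))

relabel : (ℕ → ℕ) → Filling → Filling
relabel g = map (map (map g))

joinFirst-relabel : ∀ g B F → joinFirst (map g B) (relabel g F) ≡ relabel g (joinFirst B F)
joinFirst-relabel g B [] = refl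
joinFirst-relabel g B (c ∷ F) = refl

LDD-relabel : ∀ g Y → (∀ {A B} → A ∈ Y → B ∈ Y → (map g A >D map g B) ≡ (A >D B)) →
              LDD (map (map g) Y) ≡ map (relabel g) (LDD Y)
LDD-relabel g [] _ = refl
LDD-relabel g (B ∷ []) _ = refl
LDD-relabel g (B ∷ B′ ∷ rest) pres
  rewrite LDD-relabel g (B′ ∷ rest) (λ A∈ C∈ → pres (there A∈) (there C∈)) | pres (here refl) (there (here refl))
  with B >D B′
... | true = trans (cong₂ _++_ (trans (sym (map-∘ L)) (map-∘ L)) (trans (sym (map-∘ L)) (trans (map-cong (joinFirst-relabel g B) L) (map-∘ L))))
                   (sym (map-++ (relabel g) (map ((B ∷ []) ∷_) L) (map (joinFirst B) L)))
  where L = LDD (B′ ∷ rest)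
... | false = trans (cong (_++ []) (trans (sym (map-∘ L)) (map-∘ L))) (sym (map-++ (relabel g) (map ((B ∷ []) ∷_) L) []))
  where L = LDD (B′ ∷ rest)

col-relabel : ∀ g G → (∀ {c} → c ∈ G → ∀ {a b} → a ∈ concat c → b ∈ concat c → (g a ≤ᵇ g b) ≡ (a ≤ᵇ b)) →
              col (relabel g G) ≡ map (map g) (col G)
col-relabel g [] _ = refl
col-relabel g (c ∷ G) pres = cong₂ _∷_ (trans (cong sortℕ (concat-map c)) (sortℕ-map g (concat c) (pres (here refl))))
                                       (col-relabel g G (pres ∘ there))

P-st : ∀ Y x → All (_≢ []) Y → P (st Y) x ≡ ∑[ G ← LDD Y ] M (st (col G)) x
P-st Y x Y-nonempty = begin
  ∑[ F ← LDD (st Y) ] M (col F) x                  ≡⟨ cong (λ Z → ∑[ F ← LDD Z ] M (col F) x) (st≡relabel Y) ⟩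
  ∑[ F ← LDD (map (map g) Y) ] M (col F) x         ≡⟨ cong (λ Fs → ∑[ F ← Fs ] M (col F) x) (LDD-relabel g Y >D-preserved) ⟩
  ∑[ F ← map (relabel g) (LDD Y) ] M (col F) x     ≡⟨ ∑-map (relabel g) (LDD Y) _ ⟩
  ∑[ G ← LDD Y ] M (col (relabel g G)) x           ≡⟨ ∑-cong (LDD Y) (λ G G∈ → cong (λ Z → M Z x) (columns G∈)) ⟩
  ∑[ G ← LDD Y ] M (st (col G)) x                  ∎
  where
  open ≡-Reasoning
  g = rank (concat Y)
  >D-preserved : ∀ {A B} → A ∈ Y → B ∈ Y → (map g A >D map g B) ≡ (A >D B)
  >D-preserved {[]} A∈ _ = ⊥-elim (All.lookup Y-nonempty A∈ refl)
  >D-preserved {a ∷ A} {[]} _ B∈ = ⊥-elim (All.lookup Y-nonempty B∈ refl)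
  >D-preserved {a ∷ A} {b ∷ B} _ B∈ rewrite length-map g A | length-map g B | rank-<ᵇ (concat Y) a (∈-concat⁺′ (here refl) B∈) = refl
  columns : ∀ {G} → G ∈ LDD Y → col (relabel g G) ≡ st (col G)
  columns {G} G∈ = trans (col-relabel g G (λ c∈ a∈ _ → rank-≤ᵇ (concat Y) _ (in-Y c∈ a∈)))
                         (sym (trans (st≡relabel (col G)) (map-cong (map-cong (λ z → rank-↭ z col↭Y)) (col G))))
    where
    concat≡ = proj₁ (∈-LDD⁻ Y G∈)
    col↭Y : concat (col G) ↭ concat Y
    col↭Y = ↭-trans (col-↭ G) (↭-reflexive (cong concat concat≡))
    in-Y : ∀ {c a} → c ∈ G → a ∈ concat c → a ∈ concat Y
    in-Y c∈ a∈ with ∈-concat⁻′ _ a∈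
    ... | B , a∈B , B∈c = ∈-concat⁺′ a∈B (subst (B ∈_) concat≡ (∈-concat⁺′ B∈c c∈))


-- The coproduct

coproduct-formula : ∀ {n Φ} → IsSetComp n Φ → ∀ u v →
  ΔP Φ u v ≡ ∑[ i ← upTo (suc (length Φ)) ] (P (st (take i Φ)) ⊗ P (st (drop i Φ))) u v
coproduct-formula {n} {Φ} Φ∈SC u v = begin
  ∑[ F ← LDD Φ ] ΔM (col F) u v                ≡⟨ ∑-cong (LDD Φ) (λ F _ → ΔM-col F) ⟩
  ∑[ F ← LDD Φ ] cutSum k F                    ≡⟨ LDD-splitting Φ k ⟩
  ∑[ i ← upTo (suc (length Φ)) ] splitSum k Φ i ≡⟨ ∑-cong (upTo (suc (length Φ))) (λ i _ → sym (P⊗P i)) ⟩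
  ∑[ i ← upTo (suc (length Φ)) ] (P (st (take i Φ)) ⊗ P (st (drop i Φ))) u v ∎
  where
  open ≡-Reasoning
  k : Kernel
  k G H = M (st (col G)) u * M (st (col H)) v
  column : List Block → Block
  column c = sortℕ (concat c)
  ΔM-col : ∀ F → ΔM (col F) u v ≡ cutSum k F
  ΔM-col F = trans (cong (λ ℓ → ∑[ i ← upTo (suc ℓ) ] (M (st (take i (col F))) u * M (st (drop i (col F))) v)) (length-map column F))
    (∑-cong (upTo (suc (length F))) (λ i _ → cong₂ (λ X Y → M (st X) u * M (st Y) v) (take-map i F) (drop-map i F)))
  P⊗P : ∀ i → (P (st (take i Φ)) ⊗ P (st (drop i Φ))) u v ≡ splitSum k Φ i
  P⊗P i = begin
    P (st (take i Φ)) u * P (st (drop i Φ)) v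
      ≡⟨ cong₂ _*_ (P-st (take i Φ) u (All-take⁺ i (proj₁ Φ∈SC))) (P-st (drop i Φ) v (All-drop⁺ i (proj₁ Φ∈SC))) ⟩
    (∑[ G ← LDD (take i Φ) ] M (st (col G)) u) * (∑[ H ← LDD (drop i Φ) ] M (st (col H)) v)
      ≡⟨ sym (∑-*ʳ _ (LDD (take i Φ)) _) ⟩
    ∑[ G ← LDD (take i Φ) ] (M (st (col G)) u * ∑[ H ← LDD (drop i Φ) ] M (st (col H)) v)
      ≡⟨ ∑-cong (LDD (take i Φ)) (λ G _ → sym (∑-*ˡ (M (st (col G)) u) (LDD (drop i Φ)) _)) ⟩
    splitSum k Φ i ∎

theorem4p6 : (n m : ℕ) (Φ Ψ : SetComp) → IsSetComp n Φ → IsSetComp m Ψ →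
    ((w : List ℕ) → (P Φ ⋆ P Ψ) w ≡ sum (map (λ Γ → P Γ w) (shuffle Φ (Ψ ↑ n))))
    × ((u v : List ℕ) → ΔP Φ u v
        ≡ sum (map (λ i → (P (st (take i Φ)) ⊗ P (st (drop i Φ))) u v) (upTo (suc (length Φ)))))
theorem4p6 n m Φ Ψ Φ∈SC Ψ∈SC = product-formula Φ∈SC Ψ∈SC , coproduct-formula Φ∈SC
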